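{- Let $\mu\in\mathbb N^n$ be a composition and suppose the nonsymmetric Macdonald polynomial has an expansion $E_\mu=\sum_\nu c_{\mu,\nu}F_\nu$ in ASEP polynomials, with coefficients $c_{\mu,\nu}\in\mathbb Q(q,t)$. Then $E^*_\mu=\sum_\nu c_{\mu,\nu}F^*_\nu$.
   Context: For $\nu\in\mathbb N^n$ let $k_i(\nu)=\#\{j<i:\nu_j>\nu_i\}+\#\{j>i:\nu_j\ge\nu_i\}$ and $\overline\nu=(q^{\nu_1}t^{ -k_1(\nu)},\dots,q^{\nu_n}t^{ -k_n(\nu)})$. Nonsymmetric interpolation Macdonald polynomial (Knop–Sahi): for $\mu\in\mathbb N^n$ with $|\mu|=d$, $E^*_\mu(\boldsymbol{x};q,t)$ is the unique polynomial of degree at most $d$ with coefficient of $x^\mu$ equal to $1$ and $E^*_\mu(\overline\nu)=0$ for all $\nu\in\mathbb N^n$ with $|\nu|\le d$, $\nu\ne\mu$; its top homogeneous component is the nonsymmetric Macdonald polynomial $E_\mu$. Interpolation ASEP polynomial: for a partition $\lambda$ of size $d$ and $\mu\in S_n(\lambda)$ (rearrangements of $\lambda$), $F^*_\mu$ is the unique polynomial of degree at most $d$ with coefficient of $x^\tau$ equal to $\delta_{\tau,\mu}$ for $\tau\in S_n(\lambda)$ and vanishing at $\overline\nu$ for all compositions $\nu\notin S_n(\lambda)$ with $|\nu|\le d$; its top homogeneous component is the ASEP polynomial $F_\mu$. -}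

module Defs where

open import Data.Bool using (Bool; true; false; if_then_else_; _∧_; _∨_)
open import Data.Nat as ℕ using (ℕ; zero; suc; _∸_; _≡ᵇ_; _<ᵇ_; _≤ᵇ_)
open import Data.Fin as Fin using (Fin)
open import Data.List using (List; []; _∷_; [_]; map; concatMap; upTo; allFin; filterᵇ; length; _++_; foldr)
open import Data.Vec as Vec using (Vec; []; _∷_; lookup; toList)
open import Data.Product using (_×_; _,_; proj₁)
open import Data.Rational as ℚ using (ℚ; 0ℚ; 1ℚ)
open import Relation.Binary.PropositionalEquality using (_≡_)
open import Relation.Nullary using (¬_)
open import Data.List.Relation.Unary.All using (All)

-- ℚ[q,t] : formal finite sums  Σ c q^i t^j , a term is (c , i , j)

QPoly : Set
QPoly = List (ℚ × ℕ × ℕ)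

coeffQ : QPoly → ℕ → ℕ → ℚ
coeffQ [] a b = 0ℚ
coeffQ ((c , i , j) ∷ p) a b =
  if (i ≡ᵇ a) ∧ (j ≡ᵇ b) then c ℚ.+ coeffQ p a b else coeffQ p a b

_≈Q_ : QPoly → QPoly → Set
p ≈Q r = ∀ a b → coeffQ p a b ≡ coeffQ r a b

_+Q_ : QPoly → QPoly → QPoly
p +Q r = p ++ r

_*Q_ : QPoly → QPoly → QPoly
p *Q r = concatMap (λ { (c , i , j) → map (λ { (c' , i' , j') → (c ℚ.* c' , i ℕ.+ i' , j ℕ.+ j') }) r }) p

zeroQ oneQ : QPoly
zeroQ = []
oneQ = [ (1ℚ , 0 , 0) ]

-- ℚ(q,t) : fractions num / den, equality by cross multiplication.
-- Only fractions with nonzero denominator ('Valid') are meaningful.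

record Frac : Set where
  constructor _/_
  field
    num : QPoly
    den : QPoly
open Frac public

Valid : Frac → Set
Valid f = ¬ (den f ≈Q zeroQ)

_≈F_ : Frac → Frac → Set
f ≈F g = (num f *Q den g) ≈Q (num g *Q den f)

0F 1F : Frac
0F = zeroQ / oneQ
1F = oneQ / oneQ

_+F_ : Frac → Frac → Frac
f +F g = ((num f *Q den g) +Q (num g *Q den f)) / (den f *Q den g)

_*F_ : Frac → Frac → Frac
f *F g = (num f *Q num g) / (den f *Q den g)

_^F_ : Frac → ℕ → Frac
f ^F zero = 1F
f ^F suc k = f *F (f ^F k)

qt : ℕ → ℕ → Frac
qt a k = [ (1ℚ , a , 0) ] / [ (1ℚ , 0 , k) ]

-- Polynomials in x_1..x_n over ℚ(q,t): formal finite sums of c x^α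

PolyX : ℕ → Set
PolyX n = List (Frac × Vec ℕ n)

ValidX : ∀ {n} → PolyX n → Set
ValidX P = All (λ t → Valid (proj₁ t)) P

eqVecᵇ : ∀ {n} → Vec ℕ n → Vec ℕ n → Bool
eqVecᵇ [] [] = true
eqVecᵇ (a ∷ u) (b ∷ v) = (a ≡ᵇ b) ∧ eqVecᵇ u v

coeffX : ∀ {n} → PolyX n → Vec ℕ n → Frac
coeffX [] α = 0F
coeffX ((c , β) ∷ P) α = if eqVecᵇ β α then c +F coeffX P α else coeffX P α

_≈X_ : ∀ {n} → PolyX n → PolyX n → Set
P ≈X R = ∀ α → coeffX P α ≈F coeffX R α

∣_∣ : ∀ {n} → Vec ℕ n → ℕ
∣ v ∣ = Vec.sum v

DegLe : ∀ {n} → PolyX n → ℕ → Set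
DegLe P d = ∀ α → d ℕ.< ∣ α ∣ → coeffX P α ≈F 0F

hom : ∀ {n} → ℕ → PolyX n → PolyX n
hom d P = filterᵇ (λ t → ∣ Data.Product.proj₂ t ∣ ≡ᵇ d) P

scaleX : ∀ {n} → Frac → PolyX n → PolyX n
scaleX c P = map (λ { (a , α) → (c *F a , α) }) P

lincomb : ∀ {n} → List (Vec ℕ n) → (Vec ℕ n → Frac) → (Vec ℕ n → PolyX n) → PolyX n
lincomb νs c F = concatMap (λ ν → scaleX (c ν) (F ν)) νs

monoEval : ∀ {n} → Vec Frac n → Vec ℕ n → Frac
monoEval [] [] = 1F
monoEval (x ∷ xs) (a ∷ as) = (x ^F a) *F monoEval xs as

eval : ∀ {n} → PolyX n → Vec Frac n → Frac
eval [] x = 0F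
eval ((c , α) ∷ P) x = (c *F monoEval x α) +F eval P x

kᵢ : ∀ {n} → Vec ℕ n → Fin n → ℕ
kᵢ {n} ν i = length (filterᵇ
  (λ j → ((Fin.toℕ j <ᵇ Fin.toℕ i) ∧ (lookup ν i <ᵇ lookup ν j))
       ∨ ((Fin.toℕ i <ᵇ Fin.toℕ j) ∧ (lookup ν i ≤ᵇ lookup ν j)))
  (allFin n))

bar : ∀ {n} → Vec ℕ n → Vec Frac n
bar ν = Vec.tabulate (λ i → qt (lookup ν i) (kᵢ ν i))

insert : ℕ → List ℕ → List ℕ
insert a [] = [ a ]
insert a (b ∷ l) = if a ≤ᵇ b then a ∷ b ∷ l else b ∷ insert a l

sortL : List ℕ → List ℕ
sortL = foldr insert []

eqListᵇ : List ℕ → List ℕ → Bool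
eqListᵇ [] [] = true
eqListᵇ (a ∷ u) (b ∷ v) = (a ≡ᵇ b) ∧ eqListᵇ u v
eqListᵇ _ _ = false

IsRearr : ∀ {n} → Vec ℕ n → Vec ℕ n → Set
IsRearr μ ν = sortL (toList ν) ≡ sortL (toList μ)

comps : (n d : ℕ) → List (Vec ℕ n)
comps zero zero = [ [] ]
comps zero (suc d) = []
comps (suc n) d = concatMap (λ a → map (a ∷_) (comps n (d ∸ a))) (upTo (suc d))

-- the (duplicate-free) list of all rearrangements of μ
rearr : ∀ {n} → Vec ℕ n → List (Vec ℕ n)
rearr {n} μ = filterᵇ (λ ν → eqListᵇ (sortL (toList ν)) (sortL (toList μ))) (comps n ∣ μ ∣)

record IsEstar {n} (μ : Vec ℕ n) (E : PolyX n) : Set where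
  field
    valid   : ValidX E
    degree  : DegLe E ∣ μ ∣
    leading : coeffX E μ ≈F 1F
    vanish  : ∀ ν → ∣ ν ∣ ℕ.≤ ∣ μ ∣ → ¬ (ν ≡ μ) → eval E (bar ν) ≈F 0F

record IsFstar {n} (μ : Vec ℕ n) (F : PolyX n) : Set where
  field
    valid    : ValidX F
    degree   : DegLe F ∣ μ ∣
    coeffμ   : coeffX F μ ≈F 1F
    coeffOth : ∀ τ → IsRearr μ τ → ¬ (τ ≡ μ) → coeffX F τ ≈F 0F
    vanish   : ∀ ν → ∣ ν ∣ ℕ.≤ ∣ μ ∣ → ¬ IsRearr μ ν → eval F (bar ν) ≈F 0F

{-# OPTIONS --safe #-}
module Submission where

-- Let G = E − Σ c_ν F_ν.  Its top homogeneous part vanishes by hypothesis, so deg G < |μ|, and G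
-- vanishes at every ν̄ with |ν| < |μ| because E and all F_ν do.  A polynomial P of degree ≤ m that
-- vanishes at all ν̄ with |ν| ≤ m is zero, by induction on the number n of variables and on m.
-- Write P = P(t⁻ⁿ, y) + (x₁ − t⁻ⁿ) g.  The spectral vector of 0ν is (t⁻ⁿ, ν̄), so P(t⁻ⁿ, y) vanishes
-- at all ν̄ in n − 1 variables and is zero.  The spectral vector of (x+1)v is that of vx rotated,
-- with its last entry multiplied by q, and q^{x+1} t⁻ᵏ ≠ t⁻ⁿ; hence g(q xₙ, x₁, …, xₙ₋₁) has degree
-- < m and vanishes at all ν̄ with |ν| < m, so it is zero.  Coefficients are fractions over ℚ[q,t]
-- with nonzero denominator, a commutative ring because ℚ[q,t] has no zero divisors (compare
-- lexicographically leading terms).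

open import Algebra.Bundles using (CommutativeSemiring; CommutativeRing)
open import Data.Bool using (Bool)
open import Data.Nat using (ℕ)
open import Data.Vec using (Vec)
open import Relation.Binary.PropositionalEquality using (_≡_)
open import Relation.Nullary.Reflects using (Reflects)
open import Defs

module ListSum {c ℓ} (R : CommutativeSemiring c ℓ) where

  open import Data.List using (List; []; _∷_; _++_; map; concatMap)
  open import Level using (Level)
  import Relation.Binary.PropositionalEquality as ≡

  open CommutativeSemiring R
  open import Algebra.Properties.CommutativeSemigroup +-commutativeSemigroup using (interchange)

  private variable
    a b : Level
    A : Set a
    B : Set b

  sum : (A → Carrier) → List A → Carrier
  sum f []       = 0#
  sum f (x ∷ xs) = f x + sum f xs

  sum-cong : {f g : A → Carrier} (xs : List A) → (∀ x → f x ≈ g x) → sum f xs ≈ sum g xs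
  sum-cong []       f≈g = refl
  sum-cong (x ∷ xs) f≈g = +-cong (f≈g x) (sum-cong xs f≈g)

  sum-++ : (f : A → Carrier) (xs ys : List A) → sum f (xs ++ ys) ≈ sum f xs + sum f ys
  sum-++ f []       ys = sym (+-identityˡ _)
  sum-++ f (x ∷ xs) ys = trans (+-congˡ (sum-++ f xs ys)) (sym (+-assoc _ _ _))

  sum-zero : (xs : List A) → sum (λ _ → 0#) xs ≈ 0#
  sum-zero []       = refl
  sum-zero (x ∷ xs) = trans (+-identityˡ _) (sum-zero xs)

  sum-scaled-zero : (k : A → Carrier) {f : A → Carrier} (xs : List A) → (∀ x → f x ≈ 0#) → sum (λ x → k x * f x) xs ≈ 0#
  sum-scaled-zero k xs f≈0 = trans (sum-cong xs (λ x → trans (*-congˡ (f≈0 x)) (zeroʳ (k x)))) (sum-zero xs)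

  sum-+ : (f g : A → Carrier) (xs : List A) → sum (λ x → f x + g x) xs ≈ sum f xs + sum g xs
  sum-+ f g []       = sym (+-identityˡ 0#)
  sum-+ f g (x ∷ xs) = trans (+-congˡ (sum-+ f g xs)) (interchange _ _ _ _)

  sum-*ˡ : (k : Carrier) (f : A → Carrier) (xs : List A) → sum (λ x → k * f x) xs ≈ k * sum f xs
  sum-*ˡ k f []       = sym (zeroʳ k)
  sum-*ˡ k f (x ∷ xs) = trans (+-congˡ (sum-*ˡ k f xs)) (sym (distribˡ k _ _))

  sum-swap : (F : A → B → Carrier) (xs : List A) (ys : List B) →
             sum (λ x → sum (F x) ys) xs ≈ sum (λ y → sum (λ x → F x y) xs) ys
  sum-swap F []       ys = sym (sum-zero ys)
  sum-swap F (x ∷ xs) ys = trans (+-congˡ (sum-swap F xs ys)) (sym (sum-+ (F x) _ ys))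

  sum-map : (f : B → Carrier) (g : A → B) (xs : List A) → sum f (map g xs) ≡ sum (λ x → f (g x)) xs
  sum-map f g []       = ≡.refl
  sum-map f g (x ∷ xs) = ≡.cong (f (g x) +_) (sum-map f g xs)

  sum-concatMap : (f : B → Carrier) (g : A → List B) (xs : List A) →
                  sum f (concatMap g xs) ≈ sum (λ x → sum f (g x)) xs
  sum-concatMap f g []       = refl
  sum-concatMap f g (x ∷ xs) = trans (sum-++ f (g x) (concatMap g xs)) (+-congˡ (sum-concatMap f g xs))

module FormalSum {c ℓ} (R : CommutativeRing c ℓ) {E : Set} (_==_ : E → E → Bool)
                 (==-reflects : ∀ α β → Reflects (α ≡ β) (α == β)) where

  open import Data.Bool using (true; false; if_then_else_; not)
  open import Data.Empty using (⊥-elim)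
  open import Data.List using (List; []; _∷_; _++_; map; concatMap; filterᵇ; length)
  import Data.List.Properties as ListP
  open import Data.List.Membership.Propositional using (_∈_)
  open import Data.List.Relation.Unary.Any using (here; there)
  open import Data.Nat using (suc; _≤_; s≤s)
  import Data.Nat.Properties as ℕP
  open import Data.Product using (_×_; _,_; proj₁; proj₂; map₁)
  import Relation.Binary.PropositionalEquality as ≡
  open import Relation.Binary.PropositionalEquality using (_≢_)
  open import Relation.Nullary using (¬_)
  open import Relation.Nullary.Reflects using (ofʸ; ofⁿ)
  open import Function using (_∘_)

  open CommutativeRing R
  open ListSum commutativeSemiring
  open import Algebra.Properties.Ring ring using (-1*x≈-x)
  open import Algebra.Properties.AbelianGroup +-abelianGroup using (x∙y⁻¹≈ε⇒x≈y)
  open import Algebra.Properties.CommutativeSemigroup +-commutativeSemigroup using (x∙yz≈y∙xz)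
  open import Relation.Binary.Reasoning.Setoid setoid

  FormalSum : Set c
  FormalSum = List (Carrier × E)

  coeff : FormalSum → E → Carrier
  coeff []            α = 0#
  coeff ((a , β) ∷ P) α = if β == α then a + coeff P α else coeff P α

  extend : (E → Carrier) → FormalSum → Carrier
  extend h = sum (λ t → proj₁ t * h (proj₂ t))

  scale : Carrier → FormalSum → FormalSum
  scale k = map (map₁ (k *_))

  restrict : (E → Bool) → FormalSum → FormalSum
  restrict φ = filterᵇ (λ t → φ (proj₂ t))

  without : E → FormalSum → FormalSum
  without α = restrict (λ β → not (β == α))

  linearCombination : {I : Set} → List I → (I → Carrier) → (I → FormalSum) → FormalSum
  linearCombination is k F = concatMap (λ i → scale (k i) (F i)) is

  δ : E → E → Carrier
  δ α β = if β == α then 1# else 0#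

  ==-refl : ∀ α → (α == α) ≡ true
  ==-refl α with α == α | ==-reflects α α
  ... | true  | _       = ≡.refl
  ... | false | ofⁿ α≢α = ⊥-elim (α≢α ≡.refl)

  δ-refl : ∀ α → δ α α ≈ 1#
  δ-refl α = reflexive (≡.cong (λ b → if b then 1# else 0#) (==-refl α))

  δ-≢ : ∀ α β → β ≢ α → δ α β ≈ 0#
  δ-≢ α β β≢α with β == α | ==-reflects β α
  ... | true  | ofʸ β≡α = ⊥-elim (β≢α β≡α)
  ... | false | _       = refl

  if-cong : ∀ {b b′ : Bool} {x y : Carrier} → b ≡ b′ → (if b then x else y) ≈ (if b′ then x else y)
  if-cong ≡.refl = refl

  coeff-cons : ∀ a β P α → coeff ((a , β) ∷ P) α ≈ (if β == α then a else 0#) + coeff P α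
  coeff-cons a β P α with β == α
  ... | true  = refl
  ... | false = sym (+-identityˡ _)

  coeff-++ : ∀ P Q α → coeff (P ++ Q) α ≈ coeff P α + coeff Q α
  coeff-++ []            Q α = sym (+-identityˡ _)
  coeff-++ ((a , β) ∷ P) Q α with β == α
  ... | true  = trans (+-congˡ (coeff-++ P Q α)) (sym (+-assoc a _ _))
  ... | false = coeff-++ P Q α

  coeff-scale : ∀ k P α → coeff (scale k P) α ≈ k * coeff P α
  coeff-scale k []            α = sym (zeroʳ k)
  coeff-scale k ((a , β) ∷ P) α with β == α
  ... | true  = trans (+-congˡ (coeff-scale k P α)) (sym (distribˡ k a _))
  ... | false = coeff-scale k P α

  coeff-difference : ∀ P Q α → coeff (P ++ scale (- 1#) Q) α ≈ coeff P α - coeff Q α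
  coeff-difference P Q α = trans (coeff-++ P _ α) (+-congˡ (trans (coeff-scale (- 1#) Q α) (-1*x≈-x _)))

  coeff-restrict : ∀ φ P α → coeff (restrict φ P) α ≈ (if φ α then coeff P α else 0#)
  coeff-restrict φ [] α with φ α
  ... | true  = refl
  ... | false = refl
  coeff-restrict φ ((a , β) ∷ P) α with φ β in φβ
  ... | true with β == α | ==-reflects β α
  ...   | true  | ofʸ ≡.refl = trans (+-congˡ (trans (coeff-restrict φ P β) (if-cong φβ))) (sym (if-cong φβ))
  ...   | false | _          = coeff-restrict φ P α
  coeff-restrict φ ((a , β) ∷ P) α | false with β == α | ==-reflects β α
  ...   | true  | ofʸ ≡.refl = trans (trans (coeff-restrict φ P β) (if-cong φβ)) (sym (if-cong φβ))
  ...   | false | _          = coeff-restrict φ P α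

  coeff≉0⇒∈ : ∀ P α → ¬ (coeff P α ≈ 0#) → α ∈ map proj₂ P
  coeff≉0⇒∈ []            α c≉0 = ⊥-elim (c≉0 refl)
  coeff≉0⇒∈ ((a , β) ∷ P) α c≉0 with β == α | ==-reflects β α
  ... | true  | ofʸ ≡.refl = here ≡.refl
  ... | false | _          = there (coeff≉0⇒∈ P α c≉0)

  coeff-extend : ∀ P α → coeff P α ≈ extend (δ α) P
  coeff-extend []            α = refl
  coeff-extend ((a , β) ∷ P) α with β == α
  ... | true  = +-cong (sym (*-identityʳ a)) (coeff-extend P α)
  ... | false = trans (coeff-extend P α) (sym (trans (+-congʳ (zeroʳ a)) (+-identityˡ _)))

  extend-congʰ : ∀ {h h′ : E → Carrier} P → (∀ β → h β ≈ h′ β) → extend h P ≈ extend h′ P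
  extend-congʰ P h≈h′ = sum-cong P (λ t → *-congˡ (h≈h′ (proj₂ t)))

  extend-++ : ∀ (h : E → Carrier) P Q → extend h (P ++ Q) ≈ extend h P + extend h Q
  extend-++ h = sum-++ _

  extend-scale : ∀ (h : E → Carrier) k P → extend h (scale k P) ≈ k * extend h P
  extend-scale h k []            = sym (zeroʳ k)
  extend-scale h k ((a , β) ∷ P) = trans (+-cong (*-assoc k a _) (extend-scale h k P)) (sym (distribˡ k _ _))

  extend-difference : ∀ (h : E → Carrier) P Q → extend h (P ++ scale (- 1#) Q) ≈ extend h P - extend h Q
  extend-difference h P Q = trans (extend-++ h P _) (+-congˡ (trans (extend-scale h (- 1#) Q) (-1*x≈-x _)))

  extend-restrict : ∀ (h : E → Carrier) φ P → extend h P ≈ extend h (restrict φ P) + extend h (restrict (not ∘ φ) P)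
  extend-restrict h φ []            = sym (+-identityˡ 0#)
  extend-restrict h φ ((a , β) ∷ P) with φ β
  ... | true  = trans (+-congˡ (extend-restrict h φ P)) (sym (+-assoc _ _ _))
  ... | false = trans (+-congˡ (extend-restrict h φ P)) (x∙yz≈y∙xz _ _ _)

  extend-restrict-at : ∀ (h : E → Carrier) α P → extend h (restrict (_== α) P) ≈ coeff P α * h α
  extend-restrict-at h α []            = sym (zeroˡ _)
  extend-restrict-at h α ((a , β) ∷ P) with β == α | ==-reflects β α
  ... | true  | ofʸ ≡.refl = trans (+-congˡ (extend-restrict-at h α P)) (sym (distribʳ (h α) a _))
  ... | false | _          = extend-restrict-at h α P

  extend-split : ∀ (h : E → Carrier) α P → extend h P ≈ coeff P α * h α + extend h (without α P)
  extend-split h α P = trans (extend-restrict h (_== α) P) (+-congʳ (extend-restrict-at h α P))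

  without-vanishes : ∀ (h : E → Carrier) α P → (∀ β → β ≢ α → coeff P β * h β ≈ 0#) →
                     ∀ β → coeff (without α P) β * h β ≈ 0#
  without-vanishes h α P off-α≈0 β with β == α | ==-reflects β α | coeff-restrict (λ γ → not (γ == α)) P β
  ... | true  | _       | c≈0 = trans (*-congʳ c≈0) (zeroˡ _)
  ... | false | ofⁿ β≢α | c≈c = trans (*-congʳ c≈c) (off-α≈0 β β≢α)

  without-head : ∀ a α (P : FormalSum) → without α ((a , α) ∷ P) ≡ without α P
  without-head a α P rewrite ==-refl α = ≡.refl

  -- Equal exponents may cancel, so a step removes every term with the exponent of the head.
  extend-vanishing : ∀ (h : E → Carrier) P → (∀ α → coeff P α * h α ≈ 0#) → extend h P ≈ 0#
  extend-vanishing h P = go (length P) P ℕP.≤-refl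
    where
    go : ∀ n P → length P ≤ n → (∀ α → coeff P α * h α ≈ 0#) → extend h P ≈ 0#
    go n       []            _           _   = refl
    go (suc n) ((a , α) ∷ P) (s≤s |P|≤n) P≈0 = begin
      extend h Q                                 ≈⟨ extend-split h α Q ⟩
      coeff Q α * h α + extend h (without α Q)   ≈⟨ +-cong (P≈0 α) (go n (without α Q) shorter rest≈0) ⟩
      0# + 0#                                    ≈⟨ +-identityˡ 0# ⟩
      0#                                         ∎
      where
      Q = (a , α) ∷ P
      rest≈0 : ∀ β → coeff (without α Q) β * h β ≈ 0#
      rest≈0 = without-vanishes h α Q (λ β _ → P≈0 β)
      shorter : length (without α ((a , α) ∷ P)) ≤ n
      shorter rewrite without-head a α P = ℕP.≤-trans (ListP.length-filter _ P) |P|≤n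

  extend-concentrated : ∀ (h : E → Carrier) α P → (∀ β → β ≢ α → coeff P β * h β ≈ 0#) →
                        extend h P ≈ coeff P α * h α
  extend-concentrated h α P off-α≈0 = begin
    extend h P                                 ≈⟨ extend-split h α P ⟩
    coeff P α * h α + extend h (without α P)   ≈⟨ +-congˡ (extend-vanishing h (without α P) rest≈0) ⟩
    coeff P α * h α + 0#                       ≈⟨ +-identityʳ _ ⟩
    coeff P α * h α                            ∎
    where
    rest≈0 : ∀ β → coeff (without α P) β * h β ≈ 0#
    rest≈0 = without-vanishes h α P off-α≈0

  extend-cong : ∀ (h : E → Carrier) P Q → (∀ α → coeff P α ≈ coeff Q α) → extend h P ≈ extend h Q
  extend-cong h P Q P≈Q = x∙y⁻¹≈ε⇒x≈y _ _ (trans (sym (extend-difference h P Q))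
    (extend-vanishing h (P ++ scale (- 1#) Q) λ α → trans (*-congʳ (trans (coeff-difference P Q α)
      (trans (+-congʳ (P≈Q α)) (-‿inverseʳ _)))) (zeroˡ _)))

  extend-linearCombination : ∀ {I : Set} (h : E → Carrier) (is : List I) k F →
                             extend h (linearCombination is k F) ≈ sum (λ i → k i * extend h (F i)) is
  extend-linearCombination h is k F = trans (sum-concatMap _ _ is) (sum-cong is (λ i → extend-scale h (k i) (F i)))

  coeff-linearCombination : ∀ {I : Set} (is : List I) k F α →
                            coeff (linearCombination is k F) α ≈ sum (λ i → k i * coeff (F i) α) is
  coeff-linearCombination is k F α = trans (coeff-extend (linearCombination is k F) α)
    (trans (extend-linearCombination (δ α) is k F) (sum-cong is (λ i → *-congˡ (sym (coeff-extend (F i) α)))))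

module MonoidAlgebra {c ℓ} (R : CommutativeRing c ℓ) {E : Set} (_==_ : E → E → Bool)
                     (==-reflects : ∀ α β → Reflects (α ≡ β) (α == β))
                     (_⊕_ : E → E → E) (ε : E)
                     (⊕-assoc : ∀ α β γ → (α ⊕ β) ⊕ γ ≡ α ⊕ (β ⊕ γ))
                     (⊕-comm : ∀ α β → α ⊕ β ≡ β ⊕ α)
                     (⊕-identityˡ : ∀ α → ε ⊕ α ≡ α) where

  open import Data.List using ([]; _++_; map; concatMap; [_])
  import Data.List.Properties as ListP
  open import Data.Product using (_×_; _,_; proj₁; proj₂)
  import Relation.Binary.PropositionalEquality as ≡
  import Level

  open CommutativeRing R
  open FormalSum R _==_ ==-reflects public
  open ListSum commutativeSemiring
  open import Algebra.Properties.Ring ring using (-1*x≈-x)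
  open import Algebra.Properties.CommutativeSemigroup *-commutativeSemigroup using (x∙yz≈y∙xz)
  open import Relation.Binary.Reasoning.Setoid setoid

  _·_ : Carrier × E → Carrier × E → Carrier × E
  (a , β) · (b , γ) = (a * b , β ⊕ γ)

  infixl 7 _⋆_
  _⋆_ : FormalSum → FormalSum → FormalSum
  P ⋆ Q = concatMap (λ s → map (s ·_) Q) P

  extend-·ˡ : ∀ (h : E → Carrier) a β Q → extend h (map ((a , β) ·_) Q) ≈ a * extend (λ γ → h (β ⊕ γ)) Q
  extend-·ˡ h a β Q = begin
    extend h (map ((a , β) ·_) Q)                   ≡⟨ sum-map _ ((a , β) ·_) Q ⟩
    sum (λ t → (a * proj₁ t) * h (β ⊕ proj₂ t)) Q   ≈⟨ sum-cong Q (λ t → *-assoc a _ _) ⟩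
    sum (λ t → a * (proj₁ t * h (β ⊕ proj₂ t))) Q   ≈⟨ sum-*ˡ a _ Q ⟩
    a * extend (λ γ → h (β ⊕ γ)) Q                  ∎

  extend-⋆ : ∀ (h : E → Carrier) P Q → extend h (P ⋆ Q) ≈ extend (λ β → extend (λ γ → h (β ⊕ γ)) Q) P
  extend-⋆ h P Q = trans (sum-concatMap _ _ P) (sum-cong P (λ s → extend-·ˡ h (proj₁ s) (proj₂ s) Q))

  extend-swap : ∀ (H : E → E → Carrier) P Q →
                extend (λ β → extend (H β) Q) P ≈ extend (λ γ → extend (λ β → H β γ) P) Q
  extend-swap H P Q = begin
    sum (λ s → proj₁ s * sum (λ t → proj₁ t * H (proj₂ s) (proj₂ t)) Q) P
      ≈⟨ sum-cong P (λ s → sym (sum-*ˡ (proj₁ s) _ Q)) ⟩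
    sum (λ s → sum (λ t → proj₁ s * (proj₁ t * H (proj₂ s) (proj₂ t))) Q) P
      ≈⟨ sum-swap _ P Q ⟩
    sum (λ t → sum (λ s → proj₁ s * (proj₁ t * H (proj₂ s) (proj₂ t))) P) Q
      ≈⟨ sum-cong Q (λ t → trans (sum-cong P (λ s → x∙yz≈y∙xz (proj₁ s) (proj₁ t) _)) (sum-*ˡ (proj₁ t) _ P)) ⟩
    sum (λ t → proj₁ t * sum (λ s → proj₁ s * H (proj₂ s) (proj₂ t)) P) Q ∎

  infix 4 _≋_
  record _≋_ (P Q : FormalSum) : Set (c Level.⊔ ℓ) where
    constructor coeffs≈
    field coeff-≈ : ∀ α → coeff P α ≈ coeff Q α
  open _≋_ public

  coeff-⋆ : ∀ P Q α → coeff (P ⋆ Q) α ≈ extend (λ β → extend (λ γ → δ α (β ⊕ γ)) Q) P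
  coeff-⋆ P Q α = trans (coeff-extend (P ⋆ Q) α) (extend-⋆ (δ α) P Q)

  ⋆-comm : ∀ P Q → P ⋆ Q ≋ Q ⋆ P
  ⋆-comm P Q = coeffs≈ λ α → begin
    coeff (P ⋆ Q) α                                        ≈⟨ coeff-⋆ P Q α ⟩
    extend (λ β → extend (λ γ → δ α (β ⊕ γ)) Q) P          ≈⟨ extend-swap (λ β γ → δ α (β ⊕ γ)) P Q ⟩
    extend (λ γ → extend (λ β → δ α (β ⊕ γ)) P) Q          ≈⟨ extend-congʰ Q (λ γ → extend-congʰ P (λ β →
                                                                reflexive (≡.cong (δ α) (⊕-comm β γ)))) ⟩
    extend (λ γ → extend (λ β → δ α (γ ⊕ β)) P) Q          ≈⟨ coeff-⋆ Q P α ⟨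
    coeff (Q ⋆ P) α                                        ∎

  ⋆-assoc : ∀ P Q W → (P ⋆ Q) ⋆ W ≋ P ⋆ (Q ⋆ W)
  ⋆-assoc P Q W = coeffs≈ λ α → begin
    coeff ((P ⋆ Q) ⋆ W) α
      ≈⟨ coeff-⋆ (P ⋆ Q) W α ⟩
    extend (λ β → extend (λ γ → δ α (β ⊕ γ)) W) (P ⋆ Q)
      ≈⟨ extend-⋆ _ P Q ⟩
    extend (λ β → extend (λ β′ → extend (λ γ → δ α ((β ⊕ β′) ⊕ γ)) W) Q) P
      ≈⟨ extend-congʰ P (λ β → extend-congʰ Q (λ β′ → extend-congʰ W (λ γ →
           reflexive (≡.cong (δ α) (⊕-assoc β β′ γ))))) ⟩
    extend (λ β → extend (λ β′ → extend (λ γ → δ α (β ⊕ (β′ ⊕ γ))) W) Q) P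
      ≈⟨ extend-congʰ P (λ β → extend-⋆ _ Q W) ⟨
    extend (λ β → extend (λ γ → δ α (β ⊕ γ)) (Q ⋆ W)) P
      ≈⟨ coeff-⋆ P (Q ⋆ W) α ⟨
    coeff (P ⋆ (Q ⋆ W)) α
      ∎

  ⋆-congˡ : ∀ {P P′} Q → P ≋ P′ → P ⋆ Q ≋ P′ ⋆ Q
  ⋆-congˡ {P} {P′} Q (coeffs≈ P≈P′) = coeffs≈ λ α →
    trans (coeff-⋆ P Q α) (trans (extend-cong _ P P′ P≈P′) (sym (coeff-⋆ P′ Q α)))

  ⋆-cong : ∀ {P P′ Q Q′} → P ≋ P′ → Q ≋ Q′ → P ⋆ Q ≋ P′ ⋆ Q′
  ⋆-cong {P} {P′} {Q} {Q′} P≈P′ Q≈Q′ = coeffs≈ λ α → begin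
    coeff (P ⋆ Q) α    ≈⟨ coeff-≈ (⋆-congˡ Q P≈P′) α ⟩
    coeff (P′ ⋆ Q) α   ≈⟨ coeff-≈ (⋆-comm P′ Q) α ⟩
    coeff (Q ⋆ P′) α   ≈⟨ coeff-≈ (⋆-congˡ P′ Q≈Q′) α ⟩
    coeff (Q′ ⋆ P′) α  ≈⟨ coeff-≈ (⋆-comm Q′ P′) α ⟩
    coeff (P′ ⋆ Q′) α  ∎

  ⋆-distribʳ : ∀ W P Q → (P ++ Q) ⋆ W ≋ P ⋆ W ++ Q ⋆ W
  ⋆-distribʳ W P Q = coeffs≈ λ α → begin
    coeff ((P ++ Q) ⋆ W) α                              ≈⟨ coeff-⋆ (P ++ Q) W α ⟩
    extend (λ β → extend (λ γ → δ α (β ⊕ γ)) W) (P ++ Q) ≈⟨ extend-++ _ P Q ⟩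
    extend (λ β → extend (λ γ → δ α (β ⊕ γ)) W) P
      + extend (λ β → extend (λ γ → δ α (β ⊕ γ)) W) Q   ≈⟨ +-cong (coeff-⋆ P W α) (coeff-⋆ Q W α) ⟨
    coeff (P ⋆ W) α + coeff (Q ⋆ W) α                   ≈⟨ coeff-++ (P ⋆ W) (Q ⋆ W) α ⟨
    coeff (P ⋆ W ++ Q ⋆ W) α                            ∎

  ⋆-identityˡ : ∀ P → [ (1# , ε) ] ⋆ P ≋ P
  ⋆-identityˡ P = coeffs≈ λ α → begin
    coeff ([ (1# , ε) ] ⋆ P) α                      ≈⟨ coeff-⋆ [ (1# , ε) ] P α ⟩
    1# * extend (λ γ → δ α (ε ⊕ γ)) P + 0#          ≈⟨ trans (+-identityʳ _) (*-identityˡ _) ⟩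
    extend (λ γ → δ α (ε ⊕ γ)) P
      ≈⟨ extend-congʰ P (λ γ → reflexive (≡.cong (δ α) (⊕-identityˡ γ))) ⟩
    extend (δ α) P                                  ≈⟨ coeff-extend P α ⟨
    coeff P α                                       ∎

  commutativeRing : CommutativeRing c (c Level.⊔ ℓ)
  commutativeRing = record
    { Carrier = FormalSum
    ; _≈_ = _≋_
    ; _+_ = _++_
    ; _*_ = _⋆_
    ; -_ = scale (- 1#)
    ; 0# = []
    ; 1# = [ (1# , ε) ]
    ; isCommutativeRing = record
      { isRing = record
        { +-isAbelianGroup = record
          { isGroup = record
            { isMonoid = record
              { isSemigroup = record
                { isMagma = record
                  { isEquivalence = record
                    { refl = coeffs≈ λ α → refl
                    ; sym = λ (coeffs≈ P≈Q) → coeffs≈ λ α → sym (P≈Q α)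
                    ; trans = λ (coeffs≈ P≈Q) (coeffs≈ Q≈W) → coeffs≈ λ α → trans (P≈Q α) (Q≈W α) }
                  ; ∙-cong = ++-cong }
                ; assoc = λ P Q W → coeffs≈ λ α → reflexive (≡.cong (λ X → coeff X α) (ListP.++-assoc P Q W)) }
              ; identity = (λ P → coeffs≈ λ α → refl)
                         , (λ P → coeffs≈ λ α → reflexive (≡.cong (λ X → coeff X α) (ListP.++-identityʳ P))) }
            ; inverse = (λ P → coeffs≈ λ α → trans (coeff-++ (scale (- 1#) P) P α)
                                                    (trans (+-congʳ (negated P α)) (-‿inverseˡ _)))
                      , (λ P → coeffs≈ λ α → trans (coeff-++ P (scale (- 1#) P) α)
                                                    (trans (+-congˡ (negated P α)) (-‿inverseʳ _)))
            ; ⁻¹-cong = λ {P} {Q} (coeffs≈ P≈Q) → coeffs≈ λ α →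
                trans (negated P α) (trans (-‿cong (P≈Q α)) (sym (negated Q α))) }
          ; comm = λ P Q → coeffs≈ λ α →
              trans (coeff-++ P Q α) (trans (+-comm _ _) (sym (coeff-++ Q P α))) }
        ; *-cong = ⋆-cong
        ; *-assoc = ⋆-assoc
        ; *-identity = ⋆-identityˡ , (λ P → ≋-trans (⋆-comm P _) (⋆-identityˡ P))
        ; distrib = (λ W P Q → ≋-trans (⋆-comm W (P ++ Q)) (≋-trans (⋆-distribʳ W P Q) (++-cong (⋆-comm P W) (⋆-comm Q W))))
                  , ⋆-distribʳ }
      ; *-comm = ⋆-comm } }
    where
    negated : ∀ P α → coeff (scale (- 1#) P) α ≈ - coeff P α
    negated P α = trans (coeff-scale (- 1#) P α) (-1*x≈-x _)
    ≋-trans : ∀ {P Q W} → P ≋ Q → Q ≋ W → P ≋ W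
    ≋-trans (coeffs≈ P≈Q) (coeffs≈ Q≈W) = coeffs≈ λ α → trans (P≈Q α) (Q≈W α)
    ++-cong : ∀ {P P′ Q Q′} → P ≋ P′ → Q ≋ Q′ → P ++ Q ≋ P′ ++ Q′
    ++-cong {P} {P′} {Q} {Q′} (coeffs≈ P≈P′) (coeffs≈ Q≈Q′) = coeffs≈ λ α →
      trans (coeff-++ P Q α) (trans (+-cong (P≈P′ α) (Q≈Q′ α)) (sym (coeff-++ P′ Q′ α)))
module BooleanEquality where

  open import Data.Bool using (true; false; _∧_)
  open import Data.Bool.Properties using (∧-assoc; ∧-comm)
  open import Data.Nat using (_≡ᵇ_)
  open import Data.Nat.Properties using (≡ᵇ⇒≡; ≡⇒≡ᵇ)
  open import Data.Vec using ([]; _∷_; _∷ʳ_; head; tail)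
  open import Function using (_∘_)
  open import Relation.Binary.PropositionalEquality using (refl; cong; module ≡-Reasoning)
  open import Relation.Nullary.Reflects using (ofʸ; ofⁿ; fromEquivalence)

  ≡ᵇ-reflects : ∀ m n → Reflects (m ≡ n) (m ≡ᵇ n)
  ≡ᵇ-reflects m n = fromEquivalence (≡ᵇ⇒≡ m n) (≡⇒≡ᵇ m n)

  eqVecᵇ-reflects : ∀ {n} (α β : Vec ℕ n) → Reflects (α ≡ β) (eqVecᵇ α β)
  eqVecᵇ-reflects []      []      = ofʸ refl
  eqVecᵇ-reflects (a ∷ α) (b ∷ β) with a ≡ᵇ b | ≡ᵇ-reflects a b
  ... | false | ofⁿ a≢b = ofⁿ (a≢b ∘ cong head)
  ... | true  | ofʸ refl with eqVecᵇ α β | eqVecᵇ-reflects α β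
  ...   | false | ofⁿ α≢β = ofⁿ (α≢β ∘ cong tail)
  ...   | true  | ofʸ refl = ofʸ refl

  eqVecᵇ-∷ʳ : ∀ {n} (β₀ β : Vec ℕ n) e₀ e → eqVecᵇ (β₀ ∷ʳ e₀) (β ∷ʳ e) ≡ eqVecᵇ (e₀ ∷ β₀) (e ∷ β)
  eqVecᵇ-∷ʳ []        []      e₀ e = refl
  eqVecᵇ-∷ʳ (b₀ ∷ β₀) (b ∷ β) e₀ e = begin
    (b₀ ≡ᵇ b) ∧ eqVecᵇ (β₀ ∷ʳ e₀) (β ∷ʳ e)     ≡⟨ cong ((b₀ ≡ᵇ b) ∧_) (eqVecᵇ-∷ʳ β₀ β e₀ e) ⟩
    (b₀ ≡ᵇ b) ∧ ((e₀ ≡ᵇ e) ∧ eqVecᵇ β₀ β)       ≡⟨ ∧-assoc (b₀ ≡ᵇ b) (e₀ ≡ᵇ e) _ ⟨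
    ((b₀ ≡ᵇ b) ∧ (e₀ ≡ᵇ e)) ∧ eqVecᵇ β₀ β       ≡⟨ cong (_∧ eqVecᵇ β₀ β) (∧-comm (b₀ ≡ᵇ b) (e₀ ≡ᵇ e)) ⟩
    ((e₀ ≡ᵇ e) ∧ (b₀ ≡ᵇ b)) ∧ eqVecᵇ β₀ β       ≡⟨ ∧-assoc (e₀ ≡ᵇ e) (b₀ ≡ᵇ b) _ ⟩
    (e₀ ≡ᵇ e) ∧ ((b₀ ≡ᵇ b) ∧ eqVecᵇ β₀ β)       ∎
    where open ≡-Reasoning

open BooleanEquality

module BivariatePolynomial where

  open import Data.Bool using (true; false; _∧_)
  open import Data.Empty using (⊥-elim)
  open import Data.List using (List; []; _∷_; map; filter)
  open import Data.List.Membership.Propositional using (_∈_)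
  open import Data.List.Membership.Propositional.Properties using (∈-filter⁺; ∈-filter⁻)
  open import Data.List.Relation.Unary.All as All using (All)
  open import Data.List.Relation.Unary.Any using (here; there)
  open import Data.Nat as ℕ using (_+_; _≡ᵇ_)
  import Data.Nat.Properties as ℕP
  open import Data.Product using (_×_; _,_; proj₁; proj₂)
  open import Data.Product.Relation.Binary.Lex.NonStrict using (×-totalOrder)
  open import Data.Rational as ℚ using (ℚ; 0ℚ; 1ℚ)
  import Data.Rational.Properties as ℚP
  open import Data.Sum using (inj₁; inj₂)
  open import Function using (_∘_)
  open import Level using (0ℓ)
  open import Relation.Binary.Bundles using (TotalOrder)
  open import Relation.Binary.PropositionalEquality
  open import Relation.Nullary using (¬_; Dec; yes; no; ¬?)
  open import Relation.Nullary.Decidable using (decidable-stable)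
  open import Relation.Nullary.Reflects using (ofʸ; ofⁿ)

  _==_ : ℕ × ℕ → ℕ × ℕ → Bool
  (i , j) == (a , b) = (i ≡ᵇ a) ∧ (j ≡ᵇ b)

  ==-reflects : ∀ α β → Reflects (α ≡ β) (α == β)
  ==-reflects (i , j) (a , b) with i ≡ᵇ a | ≡ᵇ-reflects i a
  ... | false | ofⁿ i≢a = ofⁿ (λ eq → i≢a (cong proj₁ eq))
  ... | true  | ofʸ refl with j ≡ᵇ b | ≡ᵇ-reflects j b
  ...   | false | ofⁿ j≢b = ofⁿ (λ eq → j≢b (cong proj₂ eq))
  ...   | true  | ofʸ refl = ofʸ refl

  _⊕_ : ℕ × ℕ → ℕ × ℕ → ℕ × ℕ
  (i , j) ⊕ (a , b) = (i + a , j + b)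

  ⊕-assoc : ∀ α β γ → (α ⊕ β) ⊕ γ ≡ α ⊕ (β ⊕ γ)
  ⊕-assoc (i , j) (a , b) (x , y) = cong₂ _,_ (ℕP.+-assoc i a x) (ℕP.+-assoc j b y)

  ⊕-comm : ∀ α β → α ⊕ β ≡ β ⊕ α
  ⊕-comm (i , j) (a , b) = cong₂ _,_ (ℕP.+-comm i a) (ℕP.+-comm j b)

  ⊕-identityˡ : ∀ α → (0 , 0) ⊕ α ≡ α
  ⊕-identityˡ α = refl

  -- ℚ[q,t] is the monoid algebra ℚ[ℕ²]; its product _⋆_ unfolds to the _*Q_ of Defs.
  open MonoidAlgebra ℚP.+-*-commutativeRing _==_ ==-reflects _⊕_ (0 , 0) ⊕-assoc ⊕-comm ⊕-identityˡ public

  coeffQ≡coeff : ∀ p a b → coeffQ p a b ≡ coeff p (a , b)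
  coeffQ≡coeff []              a b = refl
  coeffQ≡coeff ((c , i , j) ∷ p) a b rewrite coeffQ≡coeff p a b = refl

  ≈Q⇒coeff≡ : ∀ {p r} → p ≈Q r → ∀ α → coeff p α ≡ coeff r α
  ≈Q⇒coeff≡ {p} {r} p≈r (a , b) = trans (sym (coeffQ≡coeff p a b)) (trans (p≈r a b) (coeffQ≡coeff r a b))

  coeff≡⇒≈Q : ∀ {p r} → (∀ α → coeff p α ≡ coeff r α) → p ≈Q r
  coeff≡⇒≈Q {p} {r} p≈r a b = trans (coeffQ≡coeff p a b) (trans (p≈r (a , b)) (sym (coeffQ≡coeff r a b)))

  lex : TotalOrder 0ℓ 0ℓ 0ℓ
  lex = ×-totalOrder ℕP.≤-decTotalOrder ℕP.≤-totalOrder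

  open TotalOrder lex using () renaming (_≤_ to _≤ₗ_)
  open import Data.List.Extrema lex using (max; argmax-sel; ⊥≤max; xs≤max)

  ⊕-lex-rigid : ∀ {β β′ γ γ′} → β ≤ₗ β′ → γ ≤ₗ γ′ → β ⊕ γ ≡ β′ ⊕ γ′ → β ≡ β′
  ⊕-lex-rigid (inj₁ (b₁≤b₁′ , b₁≢b₁′)) γ≤γ′ eq =
    ⊥-elim (ℕP.<-irrefl (cong proj₁ eq) (ℕP.+-mono-<-≤ (ℕP.≤∧≢⇒< b₁≤b₁′ b₁≢b₁′) (first γ≤γ′)))
    where
    first : ∀ {γ γ′} → γ ≤ₗ γ′ → proj₁ γ ℕ.≤ proj₁ γ′
    first (inj₁ (g₁≤g₁′ , _)) = g₁≤g₁′
    first (inj₂ (g₁≡g₁′ , _)) = ℕP.≤-reflexive g₁≡g₁′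
  ⊕-lex-rigid {b₁ , _} (inj₂ (refl , _)) (inj₁ (_ , g₁≢g₁′)) eq =
    ⊥-elim (g₁≢g₁′ (ℕP.+-cancelˡ-≡ b₁ _ _ (cong proj₁ eq)))
  ⊕-lex-rigid {b₁ , b₂} {_ , b₂′} {_ , g₂} {_ , g₂′} (inj₂ (refl , b₂≤b₂′)) (inj₂ (refl , g₂≤g₂′)) eq =
    cong (b₁ ,_) (ℕP.≤-antisym b₂≤b₂′ (ℕP.+-cancelʳ-≤ g₂′ b₂′ b₂
      (subst (ℕ._≤ b₂ + g₂′) (cong proj₂ eq) (ℕP.+-monoʳ-≤ b₂ g₂≤g₂′))))

  record Leading (P : FormalSum) : Set where
    field
      exponent : ℕ × ℕ
      nonzero  : coeff P exponent ≢ 0ℚ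
      maximal  : ∀ β → coeff P β ≢ 0ℚ → β ≤ₗ exponent

  support : FormalSum → List (ℕ × ℕ)
  support P = filter (λ β → ¬? (coeff P β ℚ.≟ 0ℚ)) (map proj₂ P)

  ∈-support⁺ : ∀ P {α} → coeff P α ≢ 0ℚ → α ∈ support P
  ∈-support⁺ P {α} c≢0 = ∈-filter⁺ (λ β → ¬? (coeff P β ℚ.≟ 0ℚ)) (coeff≉0⇒∈ P α c≢0) c≢0

  ∈-support⁻ : ∀ P {α} → α ∈ support P → coeff P α ≢ 0ℚ
  ∈-support⁻ P α∈ = proj₂ (∈-filter⁻ (λ β → ¬? (coeff P β ℚ.≟ 0ℚ)) {xs = map proj₂ P} α∈)

  leading : ∀ P → ¬ (∀ α → coeff P α ≡ 0ℚ) → Leading P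
  leading P P≢0 with support P in supp
  ... | [] = ⊥-elim (P≢0 λ α → outside α (coeff P α ℚ.≟ 0ℚ))
    where
    outside : ∀ α → Dec (coeff P α ≡ 0ℚ) → coeff P α ≡ 0ℚ
    outside α (yes c≡0) = c≡0
    outside α (no c≢0) with () ← subst (α ∈_) supp (∈-support⁺ P c≢0)
  ... | β ∷ βs = record { exponent = max β βs ; nonzero = nonzero ; maximal = maximal }
    where
    nonzero : coeff P (max β βs) ≢ 0ℚ
    nonzero with argmax-sel (λ x → x) β βs
    ... | inj₁ max≡β  = subst (λ α → coeff P α ≢ 0ℚ) (sym max≡β)
                              (∈-support⁻ P (subst (β ∈_) (sym supp) (here refl)))
    ... | inj₂ max∈βs = ∈-support⁻ P (subst (_ ∈_) (sym supp) (there max∈βs))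
    maximal : ∀ α → coeff P α ≢ 0ℚ → α ≤ₗ max β βs
    maximal α c≢0 with subst (α ∈_) supp (∈-support⁺ P c≢0)
    ... | here refl  = ⊥≤max β βs
    ... | there α∈βs = All.lookup (xs≤max β βs) α∈βs

  ℚ-*-nonzero : ∀ {x y} → x ≢ 0ℚ → y ≢ 0ℚ → x ℚ.* y ≢ 0ℚ
  ℚ-*-nonzero {x} {y} x≢0 y≢0 xy≡0 = y≢0 (begin
    y                        ≡⟨ ℚP.*-identityˡ y ⟨
    1ℚ ℚ.* y                 ≡⟨ cong (ℚ._* y) (ℚP.*-inverseˡ x) ⟨
    (ℚ.1/ x ℚ.* x) ℚ.* y     ≡⟨ ℚP.*-assoc (ℚ.1/ x) x y ⟩
    ℚ.1/ x ℚ.* (x ℚ.* y)     ≡⟨ cong (ℚ.1/ x ℚ.*_) xy≡0 ⟩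
    ℚ.1/ x ℚ.* 0ℚ            ≡⟨ ℚP.*-zeroʳ (ℚ.1/ x) ⟩
    0ℚ                       ∎)
    where
    open ≡-Reasoning
    instance _ = ℚ.≢-nonZero x≢0

  ⊕-cancelˡ : ∀ β {γ γ′} → β ⊕ γ ≡ β ⊕ γ′ → γ ≡ γ′
  ⊕-cancelˡ (b₁ , b₂) eq =
    cong₂ _,_ (ℕP.+-cancelˡ-≡ b₁ _ _ (cong proj₁ eq)) (ℕP.+-cancelˡ-≡ b₂ _ _ (cong proj₂ eq))

  coeff-⋆-leading : ∀ {P Q} (LP : Leading P) (LQ : Leading Q) →
                    coeff (P ⋆ Q) (Leading.exponent LP ⊕ Leading.exponent LQ)
                      ≡ coeff P (Leading.exponent LP) ℚ.* coeff Q (Leading.exponent LQ)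
  coeff-⋆-leading {P} {Q} LP LQ = begin
    coeff (P ⋆ Q) α          ≡⟨ coeff-⋆ P Q α ⟩
    extend H P               ≡⟨ extend-concentrated H β₀ P H-off-β₀ ⟩
    coeff P β₀ ℚ.* H β₀      ≡⟨ cong (coeff P β₀ ℚ.*_) H-at-β₀ ⟩
    coeff P β₀ ℚ.* coeff Q γ₀ ∎
    where
    open ≡-Reasoning
    open Leading LP renaming (exponent to β₀; maximal to P-maximal) using ()
    open Leading LQ renaming (exponent to γ₀; maximal to Q-maximal) using ()
    α = β₀ ⊕ γ₀
    H : ℕ × ℕ → ℚ
    H β = extend (λ γ → δ α (β ⊕ γ)) Q
    H-at-β₀ : H β₀ ≡ coeff Q γ₀
    H-at-β₀ = begin
      H β₀                     ≡⟨ extend-concentrated (λ γ → δ α (β₀ ⊕ γ)) γ₀ Q (λ γ γ≢γ₀ →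
                                    trans (cong (coeff Q γ ℚ.*_) (δ-≢ α (β₀ ⊕ γ) (γ≢γ₀ ∘ ⊕-cancelˡ β₀)))
                                          (ℚP.*-zeroʳ (coeff Q γ))) ⟩
      coeff Q γ₀ ℚ.* δ α α     ≡⟨ cong (coeff Q γ₀ ℚ.*_) (δ-refl α) ⟩
      coeff Q γ₀ ℚ.* 1ℚ        ≡⟨ ℚP.*-identityʳ (coeff Q γ₀) ⟩
      coeff Q γ₀               ∎
    H-off-β₀ : ∀ β → β ≢ β₀ → coeff P β ℚ.* H β ≡ 0ℚ
    H-off-β₀ β β≢β₀ with coeff P β ℚ.≟ 0ℚ
    ... | yes c≡0 = trans (cong (ℚ._* H β) c≡0) (ℚP.*-zeroˡ (H β))
    ... | no c≢0  = trans (cong (coeff P β ℚ.*_) (extend-vanishing _ Q below)) (ℚP.*-zeroʳ (coeff P β))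
      where
      below : ∀ γ → coeff Q γ ℚ.* δ α (β ⊕ γ) ≡ 0ℚ
      below γ with coeff Q γ ℚ.≟ 0ℚ
      ... | yes d≡0 = trans (cong (ℚ._* δ α (β ⊕ γ)) d≡0) (ℚP.*-zeroˡ (δ α (β ⊕ γ)))
      ... | no d≢0  = trans (cong (coeff Q γ ℚ.*_) (δ-≢ α _ λ eq →
                        β≢β₀ (⊕-lex-rigid (P-maximal β c≢0) (Q-maximal γ d≢0) eq))) (ℚP.*-zeroʳ (coeff Q γ))

  *Q-nonzero : ∀ p r → ¬ (p ≈Q zeroQ) → ¬ (r ≈Q zeroQ) → ¬ ((p *Q r) ≈Q zeroQ)
  *Q-nonzero p r p≢0 r≢0 pr≡0 =
    ℚ-*-nonzero (Leading.nonzero Lp) (Leading.nonzero Lr)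
      (trans (sym (coeff-⋆-leading Lp Lr)) (≈Q⇒coeff≡ {p *Q r} {zeroQ} pr≡0 _))
    where
    Lp = leading p (p≢0 ∘ coeff≡⇒≈Q {p} {zeroQ})
    Lr = leading r (r≢0 ∘ coeff≡⇒≈Q {r} {zeroQ})

  ≈Q-stable : ∀ p r → ¬ ¬ (p ≈Q r) → p ≈Q r
  ≈Q-stable p r ¬¬p≈r a b =
    decidable-stable (coeffQ p a b ℚ.≟ coeffQ r a b) (λ p≉r → ¬¬p≈r (λ p≈r → p≉r (p≈r a b)))

  ≈Q⇒≋ : ∀ {p r} → p ≈Q r → p ≋ r
  ≈Q⇒≋ {p} {r} p≈r = coeffs≈ (≈Q⇒coeff≡ {p} {r} p≈r)

  ≋⇒≈Q : ∀ {p r} → p ≋ r → p ≈Q r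
  ≋⇒≈Q {p} {r} (coeffs≈ p≈r) = coeff≡⇒≈Q {p} {r} p≈r

module RationalFunction where

  open import Data.Bool using (if_then_else_)
  open import Data.List using ([_])
  open import Data.Nat as ℕ using (suc)
  open import Data.Product using (Σ; _,_; proj₁)
  open import Data.Rational as ℚ using (0ℚ; 1ℚ)
  import Data.Rational.Properties as ℚP
  open import Function using (_∘_)
  open import Level using (0ℓ)
  import Relation.Binary.PropositionalEquality as ≡
  open import Relation.Nullary using (¬_)

  open BivariatePolynomial
    using (_≋_; coeffs≈; coeff-≈; coeff; coeff-++; ==-refl; ≈Q⇒coeff≡; *Q-nonzero; ≈Q-stable; ≈Q⇒≋; ≋⇒≈Q)
    renaming (commutativeRing to ℚ[q,t])
  module ℚ[q,t] = CommutativeRing ℚ[q,t]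
  open ℚ[q,t] using (_+_; _*_; -_)
  open import Algebra.Solver.Ring.NaturalCoefficients.Default ℚ[q,t].commutativeSemiring using (solve; _:=_; _:+_; _:*_)
  open import Relation.Binary.Reasoning.Setoid ℚ[q,t].setoid
  open import Algebra.Properties.Ring ℚ[q,t].ring using (-‿distribˡ-*)
  open import Algebra.Properties.AbelianGroup ℚ[q,t].+-abelianGroup using (x∙y⁻¹≈ε⇒x≈y)

  *Q-cancelˡ : ∀ d x y → ¬ (d ≈Q zeroQ) → d * x ≋ d * y → x ≋ y
  *Q-cancelˡ d x y d≢0 dx≈dy = ≈Q⇒≋ (≈Q-stable x y λ x≉y → *Q-nonzero d (x + - y) d≢0
      (λ x-y≈0 → x≉y (≋⇒≈Q (x∙y⁻¹≈ε⇒x≈y x y (≈Q⇒≋ x-y≈0)))) (≋⇒≈Q d[x-y]≈0))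
    where
    d[x-y]≈0 : d * (x + - y) ≋ zeroQ
    d[x-y]≈0 = begin
      d * (x + - y)          ≈⟨ ℚ[q,t].distribˡ d x (- y) ⟩
      d * x + d * - y        ≈⟨ ℚ[q,t].+-congʳ {d * - y} dx≈dy ⟩
      d * y + d * - y        ≈⟨ ℚ[q,t].distribˡ d y (- y) ⟨
      d * (y + - y)          ≈⟨ ℚ[q,t].*-congˡ {d} (ℚ[q,t].-‿inverseʳ y) ⟩
      d * zeroQ              ≈⟨ ℚ[q,t].zeroʳ d ⟩
      zeroQ                  ∎

  oneQ≢0 : ¬ (oneQ ≈Q zeroQ)
  oneQ≢0 1≈0 = ℚP.1≢0 (≡.trans (≡.sym (ℚP.+-identityʳ 1ℚ)) (1≈0 0 0))

  RatFun : Set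
  RatFun = Σ Frac Valid

  infix 4 _≃_
  record _≃_ (x y : RatFun) : Set where
    constructor cross
    field cross-≋ : num (proj₁ x) * den (proj₁ y) ≋ num (proj₁ y) * den (proj₁ x)
  open _≃_ public

  infixl 6 _+ᶠ_
  infixl 7 _*ᶠ_
  _+ᶠ_ _*ᶠ_ : RatFun → RatFun → RatFun
  (f , f-valid) +ᶠ (g , g-valid) = f +F g , *Q-nonzero (den f) (den g) f-valid g-valid
  (f , f-valid) *ᶠ (g , g-valid) = f *F g , *Q-nonzero (den f) (den g) f-valid g-valid

  -ᶠ_ : RatFun → RatFun
  -ᶠ (f , f-valid) = (- num f) / den f , f-valid

  0ᶠ 1ᶠ : RatFun
  0ᶠ = 0F , oneQ≢0
  1ᶠ = 1F , oneQ≢0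

  ≃-trans : ∀ {x y z} → x ≃ y → y ≃ z → x ≃ z
  ≃-trans {(a / b) , _} {(c / d) , d≢0} {(e / f) , _} (cross ad≈cb) (cross cf≈ed) =
    cross (*Q-cancelˡ d (a * f) (e * b) d≢0 (begin
    d * (a * f)   ≈⟨ solve 3 (λ d a f → (d :* (a :* f)) := ((a :* d) :* f)) ℚ[q,t].refl d a f ⟩
    (a * d) * f   ≈⟨ ℚ[q,t].*-congʳ {f} ad≈cb ⟩
    (c * b) * f   ≈⟨ solve 3 (λ c b f → ((c :* b) :* f) := (b :* (c :* f))) ℚ[q,t].refl c b f ⟩
    b * (c * f)   ≈⟨ ℚ[q,t].*-congˡ {b} cf≈ed ⟩
    b * (e * d)   ≈⟨ solve 3 (λ b e d → (b :* (e :* d)) := (d :* (e :* b))) ℚ[q,t].refl b e d ⟩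
    d * (e * b)   ∎))

  +ᶠ-cong : ∀ {x x′ y y′} → x ≃ x′ → y ≃ y′ → x +ᶠ y ≃ x′ +ᶠ y′
  +ᶠ-cong {(a / b) , _} {(a′ / b′) , _} {(c / d) , _} {(c′ / d′) , _} (cross ab′≈a′b) (cross cd′≈c′d) = cross (begin
    (a * d + c * b) * (b′ * d′)
      ≈⟨ solve 6 (λ a b c d b′ d′ → (a :* d :+ c :* b) :* (b′ :* d′)
                                     := (a :* b′) :* (d :* d′) :+ (c :* d′) :* (b :* b′))
           ℚ[q,t].refl a b c d b′ d′ ⟩
    (a * b′) * (d * d′) + (c * d′) * (b * b′)
      ≈⟨ ℚ[q,t].+-cong (ℚ[q,t].*-congʳ {d * d′} ab′≈a′b) (ℚ[q,t].*-congʳ {b * b′} cd′≈c′d) ⟩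
    (a′ * b) * (d * d′) + (c′ * d) * (b * b′)
      ≈⟨ solve 6 (λ a′ b c′ d b′ d′ → (a′ :* b) :* (d :* d′) :+ (c′ :* d) :* (b :* b′)
                                       := (a′ :* d′ :+ c′ :* b′) :* (b :* d))
           ℚ[q,t].refl a′ b c′ d b′ d′ ⟩
    (a′ * d′ + c′ * b′) * (b * d) ∎)

  *ᶠ-cong : ∀ {x x′ y y′} → x ≃ x′ → y ≃ y′ → x *ᶠ y ≃ x′ *ᶠ y′
  *ᶠ-cong {(a / b) , _} {(a′ / b′) , _} {(c / d) , _} {(c′ / d′) , _} (cross ab′≈a′b) (cross cd′≈c′d) = cross (begin
    (a * c) * (b′ * d′)    ≈⟨ solve 4 (λ a c b′ d′ → (a :* c) :* (b′ :* d′) := (a :* b′) :* (c :* d′))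
                                       ℚ[q,t].refl a c b′ d′ ⟩
    (a * b′) * (c * d′)    ≈⟨ ℚ[q,t].*-cong ab′≈a′b cd′≈c′d ⟩
    (a′ * b) * (c′ * d)    ≈⟨ solve 4 (λ a′ b c′ d → (a′ :* b) :* (c′ :* d) := (a′ :* c′) :* (b :* d))
                                       ℚ[q,t].refl a′ b c′ d ⟩
    (a′ * c′) * (b * d)    ∎)

  -ᶠ-cong : ∀ {x y} → x ≃ y → -ᶠ x ≃ -ᶠ y
  -ᶠ-cong {(a / b) , _} {(a′ / b′) , _} (cross ab′≈a′b) = cross (begin
    - a * b′     ≈⟨ -‿distribˡ-* a b′ ⟨
    - (a * b′)   ≈⟨ ℚ[q,t].-‿cong ab′≈a′b ⟩
    - (a′ * b)   ≈⟨ -‿distribˡ-* a′ b ⟩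
    - a′ * b     ∎)

  +ᶠ-assoc : ∀ x y z → (x +ᶠ y) +ᶠ z ≃ x +ᶠ (y +ᶠ z)
  +ᶠ-assoc ((a / b) , _) ((c / d) , _) ((e / f) , _) = cross (solve 6 (λ a b c d e f →
    ((((a :* d) :+ (c :* b)) :* f :+ e :* (b :* d)) :* (b :* (d :* f))) :=
    ((a :* (d :* f) :+ ((c :* f) :+ (e :* d)) :* b) :* ((b :* d) :* f))) ℚ[q,t].refl a b c d e f)

  +ᶠ-comm : ∀ x y → x +ᶠ y ≃ y +ᶠ x
  +ᶠ-comm ((a / b) , _) ((c / d) , _) = cross (solve 4 (λ a b c d →
    (((a :* d) :+ (c :* b)) :* (d :* b)) := (((c :* b) :+ (a :* d)) :* (b :* d))) ℚ[q,t].refl a b c d)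

  *ᶠ-assoc : ∀ x y z → (x *ᶠ y) *ᶠ z ≃ x *ᶠ (y *ᶠ z)
  *ᶠ-assoc ((a / b) , _) ((c / d) , _) ((e / f) , _) = cross (solve 6 (λ a b c d e f →
    (((a :* c) :* e) :* (b :* (d :* f))) := ((a :* (c :* e)) :* ((b :* d) :* f))) ℚ[q,t].refl a b c d e f)

  *ᶠ-comm : ∀ x y → x *ᶠ y ≃ y *ᶠ x
  *ᶠ-comm ((a / b) , _) ((c / d) , _) = cross (solve 4 (λ a b c d →
    ((a :* c) :* (d :* b)) := ((c :* a) :* (b :* d))) ℚ[q,t].refl a b c d)

  *ᶠ-distribˡ : ∀ x y z → x *ᶠ (y +ᶠ z) ≃ x *ᶠ y +ᶠ x *ᶠ z
  *ᶠ-distribˡ ((a / b) , _) ((c / d) , _) ((e / f) , _) = cross (solve 6 (λ a b c d e f →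
    ((a :* ((c :* f) :+ (e :* d))) :* ((b :* d) :* (b :* f))) :=
    ((((a :* c) :* (b :* f)) :+ ((a :* e) :* (b :* d))) :* (b :* (d :* f)))) ℚ[q,t].refl a b c d e f)

  +ᶠ-identityˡ : ∀ x → 0ᶠ +ᶠ x ≃ x
  +ᶠ-identityˡ ((a / b) , _) = cross (begin
    (a * oneQ) * b   ≈⟨ ℚ[q,t].*-congʳ {b} (ℚ[q,t].*-identityʳ a) ⟩
    a * b            ≈⟨ ℚ[q,t].*-congˡ {a} (ℚ[q,t].*-identityˡ b) ⟨
    a * (oneQ * b)   ∎)

  *ᶠ-identityˡ : ∀ x → 1ᶠ *ᶠ x ≃ x
  *ᶠ-identityˡ ((a / b) , _) = cross (begin
    (oneQ * a) * b   ≈⟨ ℚ[q,t].*-congʳ {b} (ℚ[q,t].*-identityˡ a) ⟩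
    a * b            ≈⟨ ℚ[q,t].*-congˡ {a} (ℚ[q,t].*-identityˡ b) ⟨
    a * (oneQ * b)   ∎)

  -ᶠ-inverseˡ : ∀ x → (-ᶠ x) +ᶠ x ≃ 0ᶠ
  -ᶠ-inverseˡ ((a / b) , _) = cross (begin
    (- a * b + a * b) * oneQ   ≈⟨ ℚ[q,t].*-identityʳ _ ⟩
    - a * b + a * b            ≈⟨ ℚ[q,t].+-congʳ {a * b} (-‿distribˡ-* a b) ⟨
    - (a * b) + a * b          ≈⟨ ℚ[q,t].-‿inverseˡ (a * b) ⟩
    zeroQ                      ∎)

  ratFun : CommutativeRing 0ℓ 0ℓ
  ratFun = record
    { Carrier = RatFun ; _≈_ = _≃_ ; _+_ = _+ᶠ_ ; _*_ = _*ᶠ_ ; -_ = -ᶠ_ ; 0# = 0ᶠ ; 1# = 1ᶠ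
    ; isCommutativeRing = record
      { isRing = record
        { +-isAbelianGroup = record
          { isGroup = record
            { isMonoid = record
              { isSemigroup = record
                { isMagma = record
                  { isEquivalence = record { refl = ≃-refl ; sym = ≃-sym ; trans = ≃-trans }
                  ; ∙-cong = +ᶠ-cong }
                ; assoc = +ᶠ-assoc }
              ; identity = +ᶠ-identityˡ , (λ x → ≃-trans (+ᶠ-comm x 0ᶠ) (+ᶠ-identityˡ x)) }
            ; inverse = -ᶠ-inverseˡ , (λ x → ≃-trans (+ᶠ-comm x (-ᶠ x)) (-ᶠ-inverseˡ x))
            ; ⁻¹-cong = -ᶠ-cong }
          ; comm = +ᶠ-comm }
        ; *-cong = *ᶠ-cong
        ; *-assoc = *ᶠ-assoc
        ; *-identity = *ᶠ-identityˡ , (λ x → ≃-trans (*ᶠ-comm x 1ᶠ) (*ᶠ-identityˡ x))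
        ; distrib = *ᶠ-distribˡ , (λ x y z → ≃-trans (*ᶠ-comm (y +ᶠ z) x)
                      (≃-trans (*ᶠ-distribˡ x y z) (+ᶠ-cong (*ᶠ-comm x y) (*ᶠ-comm x z)))) }
      ; *-comm = *ᶠ-comm } }
    where
    ≃-refl : ∀ {x} → x ≃ x
    ≃-refl = cross ℚ[q,t].refl
    ≃-sym : ∀ {x y} → x ≃ y → y ≃ x
    ≃-sym (cross e) = cross (ℚ[q,t].sym e)

  ≃0⇒num≈0 : ∀ {x} → x ≃ 0ᶠ → num (proj₁ x) ≈Q zeroQ
  ≃0⇒num≈0 {x} (cross e) = ≋⇒≈Q (ℚ[q,t].trans (ℚ[q,t].sym (ℚ[q,t].*-identityʳ (num (proj₁ x)))) e)

  num≈0⇒≃0 : ∀ {x} → num (proj₁ x) ≈Q zeroQ → x ≃ 0ᶠ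
  num≈0⇒≃0 {x} e = cross (ℚ[q,t].trans (ℚ[q,t].*-identityʳ (num (proj₁ x))) (≈Q⇒≋ {num (proj₁ x)} {zeroQ} e))

  x*y≃0⇒y≃0 : ∀ x y → ¬ (x ≃ 0ᶠ) → x *ᶠ y ≃ 0ᶠ → y ≃ 0ᶠ
  x*y≃0⇒y≃0 x y x≄0 xy≃0 = num≈0⇒≃0 {y} (≈Q-stable (num (proj₁ y)) zeroQ λ y≉0 →
    *Q-nonzero (num (proj₁ x)) (num (proj₁ y)) (x≄0 ∘ num≈0⇒≃0 {x}) y≉0 (≃0⇒num≈0 {x *ᶠ y} xy≃0))

  monomial : ℕ → ℕ → QPoly
  monomial i j = [ (1ℚ , i , j) ]

  monomial≢0 : ∀ i j → ¬ (monomial i j ≈Q zeroQ)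
  monomial≢0 i j m≈0 = ℚP.1≢0 (≡.trans (≡.sym (≡.cong (λ b → if b then 1ℚ ℚ.+ 0ℚ else 0ℚ) (==-refl (i , j))))
                                        (≈Q⇒coeff≡ {monomial i j} {zeroQ} m≈0 (i , j)))

  point : ℕ → ℕ → RatFun
  point a k = qt a k , monomial≢0 0 k

  q : RatFun
  q = monomial 1 0 / oneQ , oneQ≢0

  point-suc : ∀ a k → point (suc a) k ≃ q *ᶠ point a k
  point-suc a k = cross ℚ[q,t].refl

  q≄0 : ¬ (q ≃ 0ᶠ)
  q≄0 = monomial≢0 1 0 ∘ ≃0⇒num≈0 {q}

  -- The numerator q^{a+1} tⁿ − tᵏ has coefficient 1 at q^{a+1} tⁿ.
  point-distinct : ∀ a k n → ¬ (point (suc a) k +ᶠ -ᶠ point 0 n ≃ 0ᶠ)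
  point-distinct a k n x≃0 =
    ℚP.1≢0 (≡.trans (≡.sym coeff-at-α) (≈Q⇒coeff≡ {num (proj₁ x)} {zeroQ} (≃0⇒num≈0 {x} x≃0) α))
    where
    x = point (suc a) k +ᶠ -ᶠ point 0 n
    X = monomial (suc a) 0 * monomial 0 n
    Y = - monomial 0 0 * monomial 0 k
    α = (suc a ℕ.+ 0 , n)
    coeff-at-α : coeff (num (proj₁ x)) α ≡ 1ℚ
    coeff-at-α = ≡.trans (coeff-++ X Y α) (≡.trans (ℚP.+-identityʳ (coeff X α))
      (≡.trans (≡.cong (λ b → if b then 1ℚ ℚ.* 1ℚ ℚ.+ 0ℚ else 0ℚ) (==-refl α))
               (≡.trans (ℚP.+-identityʳ (1ℚ ℚ.* 1ℚ)) (ℚP.*-identityˡ 1ℚ))))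

module Snoc where

  open import Data.Fin using (Fin; zero; suc; inject₁; fromℕ)
  open import Data.Nat using (zero; suc; _+_)
  import Data.Nat.Properties as ℕP
  open import Data.Vec using (Vec; []; _∷_; _∷ʳ_; lookup; tabulate)
  open import Function using (_∘_)
  open import Level using (Level)
  open import Relation.Binary.PropositionalEquality

  private variable
    a : Level
    A : Set a

  lookup-∷ʳ-inject₁ : ∀ {n} (v : Vec A n) x i → lookup (v ∷ʳ x) (inject₁ i) ≡ lookup v i
  lookup-∷ʳ-inject₁ (y ∷ v) x zero    = refl
  lookup-∷ʳ-inject₁ (y ∷ v) x (suc i) = lookup-∷ʳ-inject₁ v x i

  lookup-∷ʳ-last : ∀ {n} (v : Vec A n) x → lookup (v ∷ʳ x) (fromℕ n) ≡ x
  lookup-∷ʳ-last []      x = refl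
  lookup-∷ʳ-last (y ∷ v) x = lookup-∷ʳ-last v x

  tabulate-∷ʳ : ∀ n (f : Fin (suc n) → A) → tabulate f ≡ tabulate (f ∘ inject₁) ∷ʳ f (fromℕ n)
  tabulate-∷ʳ zero    f = refl
  tabulate-∷ʳ (suc n) f = cong (f zero ∷_) (tabulate-∷ʳ n (f ∘ suc))

  sum-∷ʳ : ∀ {n} (β : Vec ℕ n) e → ∣ β ∷ʳ e ∣ ≡ ∣ β ∣ + e
  sum-∷ʳ []      e = ℕP.+-identityʳ e
  sum-∷ʳ (b ∷ β) e = trans (cong (b +_) (sum-∷ʳ β e)) (sym (ℕP.+-assoc b _ e))

module Inversions where

  open import Data.Bool using (true; false; if_then_else_; _∧_; _∨_)
  open import Data.Bool.Properties using (∨-identityʳ)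
  open import Data.Empty using (⊥-elim)
  open import Data.Fin using (Fin; zero; suc; toℕ; inject₁; fromℕ)
  import Data.Fin.Properties as FinP
  open import Data.List as List using (length; filterᵇ)
  open import Data.Nat using (zero; suc; _+_; _<_; _≤_; _<ᵇ_; _≤ᵇ_)
  import Data.Nat.Properties as ℕP
  open import Data.Vec using (_∷_; lookup; _∷ʳ_)
  open import Function using (_∘_)
  open import Relation.Binary.PropositionalEquality
  open import Relation.Nullary.Reflects using (ofʸ; ofⁿ)
  open Snoc

  open ≡-Reasoning

  <ᵇ-true : ∀ {m n} → m < n → (m <ᵇ n) ≡ true
  <ᵇ-true {m} {n} m<n with m <ᵇ n | ℕP.<ᵇ-reflects-< m n
  ... | true  | _       = refl
  ... | false | ofⁿ m≮n = ⊥-elim (m≮n m<n)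

  <ᵇ-false : ∀ {m n} → n ≤ m → (m <ᵇ n) ≡ false
  <ᵇ-false {m} {n} n≤m with m <ᵇ n | ℕP.<ᵇ-reflects-< m n
  ... | true  | ofʸ m<n = ⊥-elim (ℕP.<⇒≱ m<n n≤m)
  ... | false | _       = refl

  <ᵇ-suc : ∀ m n → (m <ᵇ suc n) ≡ (m ≤ᵇ n)
  <ᵇ-suc zero    n = refl
  <ᵇ-suc (suc m) n = refl

  bit : Bool → ℕ
  bit b = if b then 1 else 0

  count : ∀ n → (Fin n → Bool) → ℕ
  count zero    p = 0
  count (suc n) p = bit (p zero) + count n (p ∘ suc)

  count-cong : ∀ n {p p′ : Fin n → Bool} → (∀ j → p j ≡ p′ j) → count n p ≡ count n p′
  count-cong zero    p≗p′ = refl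
  count-cong (suc n) p≗p′ = cong₂ _+_ (cong bit (p≗p′ zero)) (count-cong n (p≗p′ ∘ suc))

  count-true : ∀ n → count n (λ _ → true) ≡ n
  count-true zero    = refl
  count-true (suc n) = cong suc (count-true n)

  count-last : ∀ n (p : Fin (suc n) → Bool) → count (suc n) p ≡ count n (p ∘ inject₁) + bit (p (fromℕ n))
  count-last zero    p = ℕP.+-identityʳ _
  count-last (suc n) p = trans (cong (bit (p zero) +_) (count-last n (p ∘ suc))) (sym (ℕP.+-assoc (bit (p zero)) _ _))

  length-filter-tabulate : ∀ {A : Set} n (p : A → Bool) (f : Fin n → A) →
                           length (filterᵇ p (List.tabulate f)) ≡ count n (p ∘ f)
  length-filter-tabulate zero    p f = refl
  length-filter-tabulate (suc n) p f with p (f zero)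
  ... | true  = cong suc (length-filter-tabulate n p (f ∘ suc))
  ... | false = length-filter-tabulate n p (f ∘ suc)

  outranks : ∀ {n} → Vec ℕ n → Fin n → Fin n → Bool
  outranks ν i j = ((toℕ j <ᵇ toℕ i) ∧ (lookup ν i <ᵇ lookup ν j))
                 ∨ ((toℕ i <ᵇ toℕ j) ∧ (lookup ν i ≤ᵇ lookup ν j))

  kᵢ≡count : ∀ {n} (ν : Vec ℕ n) i → kᵢ ν i ≡ count n (outranks ν i)
  kᵢ≡count {n} ν i = length-filter-tabulate n (outranks ν i) (λ j → j)

  kᵢ-0∷-zero : ∀ {n} (ν : Vec ℕ n) → kᵢ (0 ∷ ν) zero ≡ n
  kᵢ-0∷-zero {n} ν = trans (kᵢ≡count (0 ∷ ν) zero) (count-true n)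

  kᵢ-0∷-suc : ∀ {n} (ν : Vec ℕ n) i → kᵢ (0 ∷ ν) (suc i) ≡ kᵢ ν i
  kᵢ-0∷-suc ν i = trans (kᵢ≡count (0 ∷ ν) (suc i)) (sym (kᵢ≡count ν i))

  kᵢ-rotate-zero : ∀ {n} (v : Vec ℕ n) x → kᵢ (suc x ∷ v) zero ≡ kᵢ (v ∷ʳ x) (fromℕ n)
  kᵢ-rotate-zero {n} v x = begin
    kᵢ (suc x ∷ v) zero                   ≡⟨ kᵢ≡count (suc x ∷ v) zero ⟩
    count n (λ j → x <ᵇ lookup v j)       ≡⟨ count-cong n earlier ⟩
    C                                     ≡⟨ ℕP.+-identityʳ C ⟨
    C + 0                                 ≡⟨ cong (λ b → C + bit b) not-self ⟨
    C + bit (outranks w last last)        ≡⟨ count-last n (outranks w last) ⟨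
    count (suc n) (outranks w last)       ≡⟨ kᵢ≡count w last ⟨
    kᵢ w last                             ∎
    where
    w = v ∷ʳ x
    last = fromℕ n
    C = count n (outranks w last ∘ inject₁)
    earlier : ∀ j → (x <ᵇ lookup v j) ≡ outranks w last (inject₁ j)
    earlier j rewrite FinP.toℕ-inject₁ j | FinP.toℕ-fromℕ n | lookup-∷ʳ-inject₁ v x j | lookup-∷ʳ-last v x
                    | <ᵇ-true (FinP.toℕ<n j) | <ᵇ-false (ℕP.<⇒≤ (FinP.toℕ<n j)) = sym (∨-identityʳ _)
    not-self : outranks w last last ≡ false
    not-self rewrite FinP.toℕ-fromℕ n | <ᵇ-false (ℕP.≤-refl {n}) = refl

  kᵢ-rotate-suc : ∀ {n} (v : Vec ℕ n) x i → kᵢ (suc x ∷ v) (suc i) ≡ kᵢ (v ∷ʳ x) (inject₁ i)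
  kᵢ-rotate-suc {n} v x i = begin
    kᵢ (suc x ∷ v) (suc i)                                             ≡⟨ kᵢ≡count (suc x ∷ v) (suc i) ⟩
    bit ((lookup v i <ᵇ suc x) ∨ false) + count n (outranks v i)         ≡⟨ cong₂ _+_ (cong bit moved) (count-cong n unmoved) ⟩
    bit (outranks w i′ last) + count n (outranks w i′ ∘ inject₁)         ≡⟨ ℕP.+-comm (bit (outranks w i′ last)) _ ⟩
    count n (outranks w i′ ∘ inject₁) + bit (outranks w i′ last)         ≡⟨ count-last n (outranks w i′) ⟨
    count (suc n) (outranks w i′)                                      ≡⟨ kᵢ≡count w i′ ⟨
    kᵢ w i′                                                            ∎
    where
    w = v ∷ʳ x
    i′ = inject₁ i
    last = fromℕ n
    unmoved : ∀ j → outranks v i j ≡ outranks w i′ (inject₁ j)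
    unmoved j rewrite FinP.toℕ-inject₁ j | FinP.toℕ-inject₁ i | lookup-∷ʳ-inject₁ v x j | lookup-∷ʳ-inject₁ v x i = refl
    moved : ((lookup v i <ᵇ suc x) ∨ false) ≡ outranks w i′ last
    moved rewrite FinP.toℕ-inject₁ i | FinP.toℕ-fromℕ n | lookup-∷ʳ-inject₁ v x i | lookup-∷ʳ-last v x
                | <ᵇ-true (FinP.toℕ<n i) | <ᵇ-false (ℕP.<⇒≤ (FinP.toℕ<n i))
                = trans (∨-identityʳ _) (<ᵇ-suc (lookup v i) x)

module Polynomial {c ℓ} (K : CommutativeRing c ℓ) where

  open import Data.Bool using (true; false; if_then_else_)
  open import Data.Empty using (⊥-elim)
  open import Data.List using (List; []; _∷_; _++_; map; concatMap)
  import Data.List.Properties as ListP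
  open import Data.List.Relation.Unary.All as All using (All; []; _∷_)
  import Data.List.Relation.Unary.All.Properties as AllP
  open import Data.Nat as ℕ using (zero; suc; _≤_; _<_; _≡ᵇ_; s≤s)
  import Data.Nat.Properties as ℕP
  open import Data.Product using (_×_; _,_; proj₂; map₂)
  open import Data.Vec using ([]; _∷_; _∷ʳ_)
  open import Function using (_∘_)
  import Relation.Binary.PropositionalEquality as ≡
  open import Relation.Nullary using (¬_)
  open import Relation.Nullary.Reflects using (ofʸ; ofⁿ)
  open Snoc using (sum-∷ʳ)

  open CommutativeRing K hiding (zero)
  open import Algebra.Properties.CommutativeSemiring.Exp commutativeSemiring public using (_^_)
  open import Algebra.Properties.CommutativeSemiring.Exp commutativeSemiring using (^-congˡ; ^-distrib-*)
  open import Algebra.Properties.CommutativeSemigroup +-commutativeSemigroup using (interchange)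
  open import Algebra.Solver.Ring.NaturalCoefficients.Default commutativeSemiring using (solve; _:=_; _:+_; _:*_; con)
  open import Relation.Binary.Reasoning.Setoid setoid

  open ListSum commutativeSemiring public

  module _ {n : ℕ} where
    open FormalSum K (eqVecᵇ {n}) eqVecᵇ-reflects public

  Poly : ℕ → Set c
  Poly n = List (Carrier × Vec ℕ n)

  mono : ∀ {n} → Vec Carrier n → Vec ℕ n → Carrier
  mono []       []      = 1#
  mono (x ∷ xs) (a ∷ α) = x ^ a * mono xs α

  ev : ∀ {n} → Poly n → Vec Carrier n → Carrier
  ev P xs = extend (mono xs) P

  Degree≤ : ∀ {n} → ℕ → Poly n → Set c
  Degree≤ m P = All (λ t → ∣ proj₂ t ∣ ≤ m) P

  Degree< : ∀ {n} → ℕ → Poly n → Set c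
  Degree< m P = All (λ t → ∣ proj₂ t ∣ < m) P

  coeff≈ev[] : ∀ (P : Poly 0) → coeff P [] ≈ ev P []
  coeff≈ev[] []             = refl
  coeff≈ev[] ((a , []) ∷ P) = +-cong (sym (*-identityʳ a)) (coeff≈ev[] P)

  ev-zero : ∀ {n} (P : Poly n) → (∀ α → coeff P α ≈ 0#) → ∀ xs → ev P xs ≈ 0#
  ev-zero P P≈0 xs = extend-vanishing (mono xs) P (λ α → trans (*-congʳ (P≈0 α)) (zeroˡ _))

  Degree<0⇒≈0 : ∀ {n} (P : Poly n) → Degree< 0 P → ∀ α → coeff P α ≈ 0#
  Degree<0⇒≈0 []      []       α = refl
  Degree<0⇒≈0 (_ ∷ _) (() ∷ _) α

  homogeneous : ∀ {n} → ℕ → Poly n → Poly n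
  homogeneous d = restrict (λ β → ∣ β ∣ ≡ᵇ d)

  coeff-homogeneous : ∀ {n d} {α : Vec ℕ n} → ∣ α ∣ ≡ d → ∀ P → coeff (homogeneous d P) α ≈ coeff P α
  coeff-homogeneous {d = d} {α} |α|≡d P
    with ∣ α ∣ ≡ᵇ d | ≡ᵇ-reflects ∣ α ∣ d | coeff-restrict (λ β → ∣ β ∣ ≡ᵇ d) P α
  ... | true  | _         | h≈P = h≈P
  ... | false | ofⁿ |α|≢d | _   = ⊥-elim (|α|≢d |α|≡d)

  module _ {n : ℕ} where

    x₀*ₜ : Carrier × Vec ℕ (suc n) → Carrier × Vec ℕ (suc n)
    x₀*ₜ (a , e ∷ β) = (a , suc e ∷ β)

    infixr 8 x₀*_
    x₀*_ : Poly (suc n) → Poly (suc n)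
    x₀* P = map x₀*ₜ P

    lift₀ : Poly n → Poly (suc n)
    lift₀ = map (map₂ (0 ∷_))

    at₀ : Carrier → Poly (suc n) → Poly n
    at₀ x = map (λ { (a , e ∷ β) → (a * x ^ e , β) })

    -- geometric x a e β = a · (x₀ᵉ − xᵉ) / (x₀ − x) · y^β = Σ_{i<e} a xᵉ⁻¹⁻ⁱ x₀ⁱ y^β
    geometric : Carrier → Carrier → ℕ → Vec ℕ n → Poly (suc n)
    geometric x a zero    β = []
    geometric x a (suc e) β = (a * x ^ e , 0 ∷ β) ∷ x₀* geometric x a e β

    quot : Carrier → Poly (suc n) → Poly (suc n)
    quot x = concatMap (λ { (a , e ∷ β) → geometric x a e β })

    rotate : Carrier → Poly (suc n) → Poly (suc n)
    rotate r = map (λ { (a , e ∷ β) → (a * r ^ e , β ∷ʳ e) })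

    ev-x₀* : ∀ (P : Poly (suc n)) x y → ev (x₀* P) (x ∷ y) ≈ x * ev P (x ∷ y)
    ev-x₀* []                  x y = sym (zeroʳ x)
    ev-x₀* ((a , e ∷ β) ∷ P) x y = trans (+-congˡ (ev-x₀* P x y))
      (solve 5 (λ a x X M W → a :* ((x :* X) :* M) :+ x :* W := x :* (a :* (X :* M) :+ W)) refl a x (x ^ e) (mono y β) (ev P (x ∷ y)))

    coeff-x₀*-zero : ∀ (P : Poly (suc n)) γ → coeff (x₀* P) (0 ∷ γ) ≡ 0#
    coeff-x₀*-zero []                  γ = ≡.refl
    coeff-x₀*-zero ((a , e ∷ β) ∷ P) γ = coeff-x₀*-zero P γ

    coeff-x₀*-suc : ∀ (P : Poly (suc n)) j γ → coeff (x₀* P) (suc j ∷ γ) ≡ coeff P (j ∷ γ)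
    coeff-x₀*-suc []                  j γ = ≡.refl
    coeff-x₀*-suc ((a , e ∷ β) ∷ P) j γ with eqVecᵇ (e ∷ β) (j ∷ γ)
    ... | true  = ≡.cong (a +_) (coeff-x₀*-suc P j γ)
    ... | false = coeff-x₀*-suc P j γ

    ev-lift₀ : ∀ (D : Poly n) x y → ev (lift₀ D) (x ∷ y) ≈ ev D y
    ev-lift₀ []            x y = refl
    ev-lift₀ ((a , β) ∷ D) x y = +-cong (*-congˡ (*-identityˡ (mono y β))) (ev-lift₀ D x y)

    ev-at₀ : ∀ x (P : Poly (suc n)) y → ev (at₀ x P) y ≈ ev P (x ∷ y)
    ev-at₀ x []                  y = refl
    ev-at₀ x ((a , e ∷ β) ∷ P) y = +-cong (*-assoc a (x ^ e) (mono y β)) (ev-at₀ x P y)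

    ev-cong₀ : ∀ (P : Poly (suc n)) {x x′} y → x ≈ x′ → ev P (x ∷ y) ≈ ev P (x′ ∷ y)
    ev-cong₀ []                  y x≈x′ = refl
    ev-cong₀ ((a , e ∷ β) ∷ P) y x≈x′ = +-cong (*-congˡ (*-congʳ (^-congˡ e x≈x′))) (ev-cong₀ P y x≈x′)

    division-term : ∀ x a e β α →
      (if eqVecᵇ (e ∷ β) α then a else 0#) + x * coeff (geometric x a e β) α
        ≈ coeff (x₀* geometric x a e β) α + (if eqVecᵇ (0 ∷ β) α then a * x ^ e else 0#)
    division-term x a zero β α with eqVecᵇ (0 ∷ β) α
    ... | true  = solve 2 (λ a x → a :+ x :* con 0 := con 0 :+ a :* con 1) refl a x
    ... | false = solve 1 (λ x → con 0 :+ x :* con 0 := con 0 :+ con 0) refl x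
    division-term x a (suc e) β (zero ∷ γ)
      rewrite coeff-x₀*-zero (geometric x a (suc e) β) γ | coeff-x₀*-zero (geometric x a e β) γ with eqVecᵇ β γ
    ... | true  = solve 3 (λ x a X → con 0 :+ x :* (a :* X :+ con 0) := con 0 :+ a :* (x :* X)) refl x a (x ^ e)
    ... | false = solve 1 (λ x → con 0 :+ x :* con 0 := con 0 :+ con 0) refl x
    division-term x a (suc e) β (suc j ∷ γ) = begin
      A + x * coeff (x₀* G) (suc j ∷ γ)      ≡⟨ ≡.cong (λ g → A + x * g) (coeff-x₀*-suc G j γ) ⟩
      A + x * coeff G (j ∷ γ)                ≈⟨ division-term x a e β (j ∷ γ) ⟩
      coeff (x₀* G) (j ∷ γ) + B              ≈⟨ +-comm _ B ⟩
      B + coeff (x₀* G) (j ∷ γ)              ≈⟨ coeff-cons (a * x ^ e) (0 ∷ β) (x₀* G) (j ∷ γ) ⟨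
      coeff (geometric x a (suc e) β) (j ∷ γ) ≡⟨ coeff-x₀*-suc (geometric x a (suc e) β) j γ ⟨
      coeff (x₀* geometric x a (suc e) β) (suc j ∷ γ) ≈⟨ +-identityʳ _ ⟨
      coeff (x₀* geometric x a (suc e) β) (suc j ∷ γ) + 0# ∎
      where
      G = geometric x a e β
      A = if eqVecᵇ (e ∷ β) (j ∷ γ) then a else 0#
      B = if eqVecᵇ (0 ∷ β) (j ∷ γ) then a * x ^ e else 0#

    -- P = P(x, y) + (x₀ − x) · quot x P, with both sides moved so that no subtraction occurs.
    division : ∀ x (P : Poly (suc n)) α →
      coeff P α + x * coeff (quot x P) α ≈ coeff (x₀* quot x P) α + coeff (lift₀ (at₀ x P)) α
    division x []                  α = solve 1 (λ x → con 0 :+ x :* con 0 := con 0 :+ con 0) refl x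
    division x ((a , e ∷ β) ∷ P) α = begin
      coeff ((a , e ∷ β) ∷ P) α + x * coeff (G ++ quot x P) α
        ≈⟨ +-cong (coeff-cons a (e ∷ β) P α) (*-congˡ (coeff-++ G (quot x P) α)) ⟩
      (A + coeff P α) + x * (coeff G α + coeff (quot x P) α)
        ≈⟨ +-congˡ (distribˡ x _ _) ⟩
      (A + coeff P α) + (x * coeff G α + x * coeff (quot x P) α)
        ≈⟨ interchange _ _ _ _ ⟩
      (A + x * coeff G α) + (coeff P α + x * coeff (quot x P) α)
        ≈⟨ +-cong (division-term x a e β α) (division x P α) ⟩
      (coeff (x₀* G) α + B) + (coeff (x₀* quot x P) α + coeff (lift₀ (at₀ x P)) α)
        ≈⟨ interchange _ _ _ _ ⟩
      (coeff (x₀* G) α + coeff (x₀* quot x P) α) + (B + coeff (lift₀ (at₀ x P)) α)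
        ≈⟨ +-cong (coeff-++ (x₀* G) (x₀* quot x P) α) (coeff-cons (a * x ^ e) (0 ∷ β) (lift₀ (at₀ x P)) α) ⟨
      coeff (x₀* G ++ x₀* quot x P) α + coeff (lift₀ (at₀ x ((a , e ∷ β) ∷ P))) α
        ≡⟨ ≡.cong (λ Q → coeff Q α + coeff (lift₀ (at₀ x ((a , e ∷ β) ∷ P))) α) (ListP.map-++ x₀*ₜ G (quot x P)) ⟨
      coeff (x₀* (G ++ quot x P)) α + coeff (lift₀ (at₀ x ((a , e ∷ β) ∷ P))) α ∎
      where
      G = geometric x a e β
      A = if eqVecᵇ (e ∷ β) α then a else 0#
      B = if eqVecᵇ (0 ∷ β) α then a * x ^ e else 0#

    ev-division : ∀ x (P : Poly (suc n)) z y →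
      ev P (z ∷ y) + x * ev (quot x P) (z ∷ y) ≈ z * ev (quot x P) (z ∷ y) + ev (at₀ x P) y
    ev-division x P z y = begin
      ev P (z ∷ y) + x * ev g (z ∷ y)             ≈⟨ +-congˡ (extend-scale _ x g) ⟨
      ev P (z ∷ y) + ev (scale x g) (z ∷ y)       ≈⟨ extend-++ _ P (scale x g) ⟨
      ev (P ++ scale x g) (z ∷ y)                 ≈⟨ extend-cong _ (P ++ scale x g) (x₀* g ++ lift₀ (at₀ x P)) same-coeffs ⟩
      ev (x₀* g ++ lift₀ (at₀ x P)) (z ∷ y)       ≈⟨ extend-++ _ (x₀* g) (lift₀ (at₀ x P)) ⟩
      ev (x₀* g) (z ∷ y) + ev (lift₀ (at₀ x P)) (z ∷ y) ≈⟨ +-cong (ev-x₀* g z y) (ev-lift₀ (at₀ x P) z y) ⟩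
      z * ev g (z ∷ y) + ev (at₀ x P) y           ∎
      where
      g = quot x P
      same-coeffs : ∀ α → coeff (P ++ scale x g) α ≈ coeff (x₀* g ++ lift₀ (at₀ x P)) α
      same-coeffs α = trans (coeff-++ P (scale x g) α) (trans (+-congˡ (coeff-scale x g α))
                        (trans (division x P α) (sym (coeff-++ (x₀* g) (lift₀ (at₀ x P)) α))))

  mono-∷ʳ : ∀ {n} (w : Vec Carrier n) z (β : Vec ℕ n) e → mono (w ∷ʳ z) (β ∷ʳ e) ≈ mono w β * z ^ e
  mono-∷ʳ []      z []      e = trans (*-identityʳ _) (sym (*-identityˡ _))
  mono-∷ʳ (x ∷ w) z (b ∷ β) e = trans (*-congˡ (mono-∷ʳ w z β e)) (sym (*-assoc _ _ _))

  module _ {n : ℕ} where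

    ev-rotate : ∀ r (P : Poly (suc n)) w z → ev (rotate r P) (w ∷ʳ z) ≈ ev P (r * z ∷ w)
    ev-rotate r []                  w z = refl
    ev-rotate r ((a , e ∷ β) ∷ P) w z = +-cong (begin
      (a * r ^ e) * mono (w ∷ʳ z) (β ∷ʳ e)   ≈⟨ *-congˡ (mono-∷ʳ w z β e) ⟩
      (a * r ^ e) * (mono w β * z ^ e)       ≈⟨ solve 4 (λ a R M Z → (a :* R) :* (M :* Z) := a :* ((R :* Z) :* M))
                                                        refl a (r ^ e) (mono w β) (z ^ e) ⟩
      a * ((r ^ e * z ^ e) * mono w β)       ≈⟨ *-congˡ (*-congʳ (^-distrib-* r z e)) ⟨
      a * ((r * z) ^ e * mono w β)           ∎) (ev-rotate r P w z)

    coeff-rotate : ∀ r (P : Poly (suc n)) β e → coeff (rotate r P) (β ∷ʳ e) ≈ r ^ e * coeff P (e ∷ β)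
    coeff-rotate r []                    β e = sym (zeroʳ _)
    coeff-rotate r ((a , e₀ ∷ β₀) ∷ P) β e rewrite eqVecᵇ-∷ʳ β₀ β e₀ e
      with eqVecᵇ (e₀ ∷ β₀) (e ∷ β) | eqVecᵇ-reflects (e₀ ∷ β₀) (e ∷ β)
    ... | false | _          = coeff-rotate r P β e
    ... | true  | ofʸ ≡.refl = trans (+-congˡ (coeff-rotate r P β e))
                                 (solve 3 (λ a R X → a :* R :+ R :* X := R :* (a :+ X)) refl a (r ^ e) (coeff P (e ∷ β)))

    x₀*-degree : ∀ {m} (P : Poly (suc n)) → Degree< m P → Degree< (suc m) (x₀* P)
    x₀*-degree []                  []          = []
    x₀*-degree ((a , e ∷ β) ∷ P) (t<m ∷ P<m) = s≤s t<m ∷ x₀*-degree P P<m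

    geometric-degree : ∀ x a e (β : Vec ℕ n) → Degree< (e ℕ.+ ∣ β ∣) (geometric x a e β)
    geometric-degree x a zero    β = []
    geometric-degree x a (suc e) β = s≤s (ℕP.m≤n+m ∣ β ∣ e) ∷ x₀*-degree (geometric x a e β) (geometric-degree x a e β)

    quot-degree : ∀ {m} x (P : Poly (suc n)) → Degree≤ m P → Degree< m (quot x P)
    quot-degree x []                  []          = []
    quot-degree x ((a , e ∷ β) ∷ P) (t≤m ∷ P≤m) =
      AllP.++⁺ (All.map (λ t<e+β → ℕP.<-≤-trans t<e+β t≤m) (geometric-degree x a e β)) (quot-degree x P P≤m)

    at₀-degree : ∀ {m} x (P : Poly (suc n)) → Degree≤ m P → Degree≤ m (at₀ x P)
    at₀-degree x []                  []          = []
    at₀-degree x ((a , e ∷ β) ∷ P) (t≤m ∷ P≤m) = ℕP.≤-trans (ℕP.m≤n+m ∣ β ∣ e) t≤m ∷ at₀-degree x P P≤m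

    rotate-degree : ∀ {m} r (P : Poly (suc n)) → Degree< (suc m) P → Degree≤ m (rotate r P)
    rotate-degree r []                  []                = []
    rotate-degree {m} r ((a , e ∷ β) ∷ P) (s≤s t≤m ∷ P<m) =
      ≡.subst (_≤ m) (≡.trans (ℕP.+-comm e ∣ β ∣) (≡.sym (sum-∷ʳ β e))) t≤m ∷ rotate-degree r P P<m

    coeff-lift₀-zero : ∀ (D : Poly n) γ → coeff (lift₀ D) (0 ∷ γ) ≡ coeff D γ
    coeff-lift₀-zero []            γ = ≡.refl
    coeff-lift₀-zero ((a , β) ∷ D) γ rewrite coeff-lift₀-zero D γ = ≡.refl

    coeff-lift₀-suc : ∀ (D : Poly n) j γ → coeff (lift₀ D) (suc j ∷ γ) ≡ 0#
    coeff-lift₀-suc []            j γ = ≡.refl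
    coeff-lift₀-suc ((a , β) ∷ D) j γ = coeff-lift₀-suc D j γ

  module Interpolation
    (x*y≈0⇒y≈0 : ∀ x y → ¬ (x ≈ 0#) → x * y ≈ 0# → y ≈ 0#)
    (q : Carrier) (q≉0 : ¬ (q ≈ 0#))
    (point : ℕ → ℕ → Carrier)
    (point-suc : ∀ a k → point (suc a) k ≈ q * point a k)
    (point-distinct : ∀ a k n → ¬ (point (suc a) k - point 0 n ≈ 0#))
    where

    open import Data.Bool using (T?)
    open import Data.Fin using (inject₁; fromℕ)
    open import Data.Nat using (_<ᵇ_; z≤n)
    open import Data.Sum using (inj₁; inj₂)
    open import Data.Vec as Vec using (lookup)
    import Data.Vec.Properties as VecP
    open import Algebra.Properties.Ring ring using (-‿distribˡ-*)
    open import Algebra.Properties.AbelianGroup +-abelianGroup using (x∙y⁻¹≈ε⇒x≈y)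
    open Inversions
    open Snoc

    spectral : ∀ {n} → Vec ℕ n → Vec Carrier n
    spectral ν = Vec.tabulate (λ i → point (lookup ν i) (kᵢ ν i))

    spectral-0∷ : ∀ {n} (ν : Vec ℕ n) → spectral (0 ∷ ν) ≡ point 0 n ∷ spectral ν
    spectral-0∷ ν = ≡.cong₂ _∷_ (≡.cong (point 0) (kᵢ-0∷-zero ν))
                                (VecP.tabulate-cong (λ i → ≡.cong (point (lookup ν i)) (kᵢ-0∷-suc ν i)))

    rotated : ∀ {n} → Vec ℕ n → ℕ → Vec Carrier n
    rotated v x = Vec.tabulate (λ i → point (lookup v i) (kᵢ (v ∷ʳ x) (inject₁ i)))

    spectral-suc∷ : ∀ {n} (v : Vec ℕ n) x →
                    spectral (suc x ∷ v) ≡ point (suc x) (kᵢ (v ∷ʳ x) (fromℕ n)) ∷ rotated v x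
    spectral-suc∷ v x = ≡.cong₂ _∷_ (≡.cong (point (suc x)) (kᵢ-rotate-zero v x))
                                    (VecP.tabulate-cong (λ i → ≡.cong (point (lookup v i)) (kᵢ-rotate-suc v x i)))

    spectral-∷ʳ : ∀ {n} (v : Vec ℕ n) x →
                  spectral (v ∷ʳ x) ≡ rotated v x ∷ʳ point x (kᵢ (v ∷ʳ x) (fromℕ n))
    spectral-∷ʳ {n} v x = ≡.trans (tabulate-∷ʳ n (λ i → point (lookup (v ∷ʳ x) i) (kᵢ (v ∷ʳ x) i)))
      (≡.cong₂ _∷ʳ_ (VecP.tabulate-cong (λ i → ≡.cong (λ a → point a (kᵢ (v ∷ʳ x) (inject₁ i))) (lookup-∷ʳ-inject₁ v x i)))
                    (≡.cong (λ a → point a (kᵢ (v ∷ʳ x) (fromℕ n))) (lookup-∷ʳ-last v x)))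

    q^≉0 : ∀ e → ¬ (q ^ e ≈ 0#)
    q^≉0 zero    1≈0   = q≉0 (trans (sym (*-identityʳ q)) (trans (*-congˡ 1≈0) (zeroʳ q)))
    q^≉0 (suc e) q^e+1≈0 = q^≉0 e (x*y≈0⇒y≈0 q (q ^ e) q≉0 q^e+1≈0)

    VanishesUpTo : ∀ {n} → ℕ → Poly n → Set ℓ
    VanishesUpTo m P = ∀ ν → ∣ ν ∣ ≤ m → ev P (spectral ν) ≈ 0#

    module _ {n : ℕ} (P : Poly (suc n)) where

      private
        a = point 0 n

      at₀-vanishes : ∀ {m} → VanishesUpTo m P → VanishesUpTo m (at₀ a P)
      at₀-vanishes P-vanishes ν |ν|≤m = begin
        ev (at₀ a P) (spectral ν)   ≈⟨ ev-at₀ a P (spectral ν) ⟩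
        ev P (a ∷ spectral ν)       ≡⟨ ≡.cong (ev P) (spectral-0∷ ν) ⟨
        ev P (spectral (0 ∷ ν))     ≈⟨ P-vanishes (0 ∷ ν) |ν|≤m ⟩
        0#                          ∎

      quot-vanishes : ∀ {m} → (∀ γ → coeff (at₀ a P) γ ≈ 0#) → VanishesUpTo m P →
                      ∀ v x → suc x ℕ.+ ∣ v ∣ ≤ m → ev (quot a P) (spectral (suc x ∷ v)) ≈ 0#
      quot-vanishes D≈0 P-vanishes v x size≤m rewrite spectral-suc∷ v x =
        x*y≈0⇒y≈0 (X - a) W (point-distinct x _ n) (begin
          (X - a) * W         ≈⟨ distribʳ W X (- a) ⟩
          X * W + - a * W     ≈⟨ +-congˡ (-‿distribˡ-* a W) ⟨
          X * W - a * W       ≈⟨ +-congʳ X*W≈a*W ⟩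
          a * W - a * W       ≈⟨ -‿inverseʳ (a * W) ⟩
          0#                  ∎)
        where
        X = point (suc x) (kᵢ (v ∷ʳ x) (fromℕ n))
        Y = rotated v x
        W = ev (quot a P) (X ∷ Y)
        P[X∷Y]≈0 : ev P (X ∷ Y) ≈ 0#
        P[X∷Y]≈0 = ≡.subst (λ xs → ev P xs ≈ 0#) (spectral-suc∷ v x) (P-vanishes (suc x ∷ v) size≤m)
        X*W≈a*W : X * W ≈ a * W
        X*W≈a*W = begin
          X * W                                   ≈⟨ +-identityʳ _ ⟨
          X * W + 0#                              ≈⟨ +-congˡ (ev-zero (at₀ a P) D≈0 Y) ⟨
          X * W + ev (at₀ a P) Y                  ≈⟨ ev-division a P X Y ⟨
          ev P (X ∷ Y) + a * W                    ≈⟨ +-congʳ P[X∷Y]≈0 ⟩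
          0# + a * W                              ≈⟨ +-identityˡ _ ⟩
          a * W                                   ∎

      division≈0 : (∀ γ → coeff (at₀ a P) γ ≈ 0#) → (∀ α → coeff (quot a P) α ≈ 0#) → ∀ α → coeff P α ≈ 0#
      division≈0 D≈0 g≈0 (j ∷ γ) = begin
        coeff P (j ∷ γ)                                     ≈⟨ +-identityʳ _ ⟨
        coeff P (j ∷ γ) + 0#                                ≈⟨ +-congˡ (trans (*-congˡ (g≈0 (j ∷ γ))) (zeroʳ a)) ⟨
        coeff P (j ∷ γ) + a * coeff g (j ∷ γ)               ≈⟨ division a P (j ∷ γ) ⟩
        coeff (x₀* g) (j ∷ γ) + coeff (lift₀ D) (j ∷ γ)     ≈⟨ +-cong (x₀*g≈0 j) (lift₀D≈0 j) ⟩
        0# + 0#                                             ≈⟨ +-identityʳ 0# ⟩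
        0#                                                  ∎
        where
        g = quot a P
        D = at₀ a P
        x₀*g≈0 : ∀ j → coeff (x₀* g) (j ∷ γ) ≈ 0#
        x₀*g≈0 zero    = reflexive (coeff-x₀*-zero g γ)
        x₀*g≈0 (suc j) = trans (reflexive (coeff-x₀*-suc g j γ)) (g≈0 (j ∷ γ))
        lift₀D≈0 : ∀ j → coeff (lift₀ D) (j ∷ γ) ≈ 0#
        lift₀D≈0 zero    = trans (reflexive (coeff-lift₀-zero D γ)) (D≈0 γ)
        lift₀D≈0 (suc j) = reflexive (coeff-lift₀-suc D j γ)

    module _ {n : ℕ} (g : Poly (suc n)) where

      rotate-vanishes : ∀ {m} → (∀ v x → suc x ℕ.+ ∣ v ∣ ≤ suc m → ev g (spectral (suc x ∷ v)) ≈ 0#) →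
                        VanishesUpTo m (rotate q g)
      rotate-vanishes {m} g-vanishes ν |ν|≤m with Vec.initLast ν
      ... | v , x , ≡.refl = begin
        ev (rotate q g) (spectral (v ∷ʳ x))                    ≡⟨ ≡.cong (ev (rotate q g)) (spectral-∷ʳ v x) ⟩
        ev (rotate q g) (rotated v x ∷ʳ point x k)        ≈⟨ ev-rotate q g (rotated v x) (point x k) ⟩
        ev g (q * point x k ∷ rotated v x)                ≈⟨ ev-cong₀ g (rotated v x) (point-suc x k) ⟨
        ev g (point (suc x) k ∷ rotated v x)              ≡⟨ ≡.cong (ev g) (spectral-suc∷ v x) ⟨
        ev g (spectral (suc x ∷ v))                            ≈⟨ g-vanishes v x (s≤s size≤m) ⟩
        0#                                                ∎
        where
        k = kᵢ (v ∷ʳ x) (fromℕ n)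
        size≤m : x ℕ.+ ∣ v ∣ ≤ m
        size≤m = ≡.subst (_≤ m) (≡.trans (sum-∷ʳ v x) (ℕP.+-comm ∣ v ∣ x)) |ν|≤m

      rotate≈0 : (∀ α → coeff (rotate q g) α ≈ 0#) → ∀ α → coeff g α ≈ 0#
      rotate≈0 rot≈0 (e ∷ β) = x*y≈0⇒y≈0 (q ^ e) (coeff g (e ∷ β)) (q^≉0 e)
        (trans (sym (coeff-rotate q g β e)) (rot≈0 (β ∷ʳ e)))

    vanishing : ∀ n m (P : Poly n) → Degree≤ m P → VanishesUpTo m P → ∀ α → coeff P α ≈ 0#
    vanishing zero    m       P _   P-vanishes [] = trans (coeff≈ev[] P) (P-vanishes [] z≤n)
    vanishing (suc n) zero    P P≤0 P-vanishes =
      division≈0 P D≈0 (Degree<0⇒≈0 (quot (point 0 n) P) (quot-degree (point 0 n) P P≤0))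
      where
      D≈0 = vanishing n zero (at₀ (point 0 n) P) (at₀-degree (point 0 n) P P≤0) (at₀-vanishes P P-vanishes)
    vanishing (suc n) (suc m) P P≤m P-vanishes =
      division≈0 P D≈0 (rotate≈0 g (vanishing (suc n) m (rotate q g) (rotate-degree q g (quot-degree (point 0 n) P P≤m))
                                      (rotate-vanishes g (quot-vanishes P D≈0 P-vanishes))))
      where
      g = quot (point 0 n) P
      D≈0 = vanishing n (suc m) (at₀ (point 0 n) P) (at₀-degree (point 0 n) P P≤m) (at₀-vanishes P P-vanishes)

    vanishing-below : ∀ {n} d (P : Poly n) → (∀ α → d ≤ ∣ α ∣ → coeff P α ≈ 0#) →
                      (∀ ν → ∣ ν ∣ < d → ev P (spectral ν) ≈ 0#) → ∀ α → coeff P α ≈ 0#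
    vanishing-below         zero    P high _   α = high α z≤n
    vanishing-below {n} (suc m) P high low α =
      trans (sym (truncated α)) (vanishing n m T T≤m T-vanishes α)
      where
      T = restrict (λ β → ∣ β ∣ <ᵇ suc m) P
      truncated : ∀ α → coeff T α ≈ coeff P α
      truncated α with ∣ α ∣ <ᵇ suc m | ℕP.<ᵇ-reflects-< ∣ α ∣ (suc m)
                     | coeff-restrict (λ β → ∣ β ∣ <ᵇ suc m) P α
      ... | true  | _       | T≈P = T≈P
      ... | false | ofⁿ α≮ | T≈0 = trans T≈0 (sym (high α (ℕP.≮⇒≥ α≮)))
      T≤m : Degree≤ m T
      T≤m = All.map (λ {t} t<ᵇ → ℕ.s≤s⁻¹ (ℕP.<ᵇ⇒< ∣ proj₂ t ∣ (suc m) t<ᵇ))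
                    (AllP.all-filter (λ t → T? (∣ proj₂ t ∣ <ᵇ suc m)) P)
      T-vanishes : VanishesUpTo m T
      T-vanishes ν |ν|≤m = trans (extend-cong _ T P truncated) (low ν (s≤s |ν|≤m))

    top-degree-determines : ∀ {n} {I : Set} d (E : Poly n) (is : List I) (k : I → Carrier) (F : I → Poly n) →
      (∀ α → d < ∣ α ∣ → coeff E α ≈ 0#) → (∀ ν → ∣ ν ∣ < d → ev E (spectral ν) ≈ 0#) →
      (∀ i α → d < ∣ α ∣ → coeff (F i) α ≈ 0#) → (∀ i ν → ∣ ν ∣ < d → ev (F i) (spectral ν) ≈ 0#) →
      (∀ α → coeff (homogeneous d E) α ≈ coeff (linearCombination is k (homogeneous d ∘ F)) α) →
      ∀ α → coeff E α ≈ coeff (linearCombination is k F) α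
    top-degree-determines d E is k F E-high E-low F-high F-low top α =
      x∙y⁻¹≈ε⇒x≈y _ _ (trans (sym (coeff-difference E L α)) (vanishing-below d (E ++ scale (- 1#) L) high low α))
      where
      L = linearCombination is k F

      x-y≈0 : ∀ {x y} → x ≈ 0# → y ≈ 0# → x - y ≈ 0#
      x-y≈0 x≈0 y≈0 = trans (+-cong x≈0 (-‿cong y≈0)) (-‿inverseʳ 0#)

      top-agrees : ∀ α → ∣ α ∣ ≡ d → coeff E α ≈ coeff L α
      top-agrees α |α|≡d = begin
        coeff E α                                                    ≈⟨ coeff-homogeneous |α|≡d E ⟨
        coeff (homogeneous d E) α                                    ≈⟨ top α ⟩
        coeff (linearCombination is k (homogeneous d ∘ F)) α         ≈⟨ coeff-linearCombination is k (homogeneous d ∘ F) α ⟩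
        sum (λ i → k i * coeff (homogeneous d (F i)) α) is
          ≈⟨ sum-cong is (λ i → *-congˡ (coeff-homogeneous |α|≡d (F i))) ⟩
        sum (λ i → k i * coeff (F i) α) is                           ≈⟨ coeff-linearCombination is k F α ⟨
        coeff L α                                                    ∎

      high : ∀ α → d ≤ ∣ α ∣ → coeff (E ++ scale (- 1#) L) α ≈ 0#
      high α d≤α with ℕP.m≤n⇒m<n∨m≡n d≤α
      ... | inj₁ d<α = trans (coeff-difference E L α) (x-y≈0 (E-high α d<α)
                         (trans (coeff-linearCombination is k F α) (sum-scaled-zero k is (λ i → F-high i α d<α))))
      ... | inj₂ d≡α = trans (coeff-difference E L α) (trans (+-congʳ (top-agrees α (≡.sym d≡α))) (-‿inverseʳ _))

      low : ∀ ν → ∣ ν ∣ < d → ev (E ++ scale (- 1#) L) (spectral ν) ≈ 0#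
      low ν ν<d = trans (extend-difference _ E L) (x-y≈0 (E-low ν ν<d)
                    (trans (extend-linearCombination _ is k F) (sum-scaled-zero k is (λ i → F-low i ν ν<d))))

module Rearrangement where

  open import Data.Bool using (true; false; T; T?)
  open import Data.List using ([]; _∷_)
  open import Data.List.Relation.Unary.All as All using (All)
  import Data.List.Relation.Unary.All.Properties as AllP
  open import Data.Nat using (_+_; _≤ᵇ_; _≡ᵇ_)
  open import Data.Nat.ListAction using (sum)
  import Data.Nat.Properties as ℕP
  open import Algebra.Properties.CommutativeSemigroup ℕP.+-commutativeSemigroup using (x∙yz≈y∙xz)
  open import Data.Vec using ([]; _∷_; toList)
  open import Relation.Binary.PropositionalEquality

  sum-insert : ∀ a l → sum (insert a l) ≡ a + sum l
  sum-insert a []      = refl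
  sum-insert a (b ∷ l) with a ≤ᵇ b
  ... | true  = refl
  ... | false = trans (cong (b +_) (sum-insert a l)) (x∙yz≈y∙xz b a (sum l))

  sum-sortL : ∀ l → sum (sortL l) ≡ sum l
  sum-sortL []      = refl
  sum-sortL (a ∷ l) = trans (sum-insert a (sortL l)) (cong (a +_) (sum-sortL l))

  sum-toList : ∀ {n} (v : Vec ℕ n) → sum (toList v) ≡ ∣ v ∣
  sum-toList []      = refl
  sum-toList (x ∷ v) = cong (x +_) (sum-toList v)

  rearrangement-size : ∀ {n} (μ ν : Vec ℕ n) → IsRearr μ ν → ∣ ν ∣ ≡ ∣ μ ∣
  rearrangement-size μ ν ν~μ = begin
    ∣ ν ∣                      ≡⟨ sum-toList ν ⟨
    sum (toList ν)         ≡⟨ sum-sortL (toList ν) ⟨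
    sum (sortL (toList ν)) ≡⟨ cong sum ν~μ ⟩
    sum (sortL (toList μ)) ≡⟨ sum-sortL (toList μ) ⟩
    sum (toList μ)         ≡⟨ sum-toList μ ⟩
    ∣ μ ∣                      ∎
    where open ≡-Reasoning

  eqListᵇ⇒≡ : ∀ l l′ → T (eqListᵇ l l′) → l ≡ l′
  eqListᵇ⇒≡ []      []       _  = refl
  eqListᵇ⇒≡ (a ∷ l) (b ∷ l′) eq with a ≡ᵇ b in a=b
  ... | true = cong₂ _∷_ (ℕP.≡ᵇ⇒≡ a b (subst T (sym a=b) _)) (eqListᵇ⇒≡ l l′ eq)

  rearr-sound : ∀ {n} (μ : Vec ℕ n) → All (IsRearr μ) (rearr μ)
  rearr-sound {n} μ = All.map (λ {ν} → eqListᵇ⇒≡ (sortL (toList ν)) (sortL (toList μ)))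
    (AllP.all-filter (λ ν → T? (eqListᵇ (sortL (toList ν)) (sortL (toList μ)))) (comps n ∣ μ ∣))

module Transfer where

  open import Data.Bool using (true; false; if_then_else_)
  open import Data.List using (List; []; _∷_; _++_; map)
  import Data.List.Properties as ListP
  open import Data.List.Relation.Unary.All using ([]; _∷_)
  open import Data.Nat using (zero; suc; _≡ᵇ_)
  open import Data.Product using (_,_; proj₁; map₁)
  open import Data.Vec as Vec using ([]; _∷_)
  import Data.Vec.Properties as VecP
  open import Relation.Binary.PropositionalEquality
  open RationalFunction
  open Polynomial ratFun public
  open Interpolation x*y≃0⇒y≃0 q q≄0 point point-suc point-distinct public

  erase : ∀ {n} → Poly n → PolyX n
  erase = map (map₁ proj₁)

  lift : ∀ {n} (P : PolyX n) → ValidX P → Poly n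
  lift []            []                = []
  lift ((a , α) ∷ P) (a-valid ∷ P-valid) = ((a , a-valid) , α) ∷ lift P P-valid

  erase-lift : ∀ {n} (P : PolyX n) (P-valid : ValidX P) → erase (lift P P-valid) ≡ P
  erase-lift []            []            = refl
  erase-lift ((a , α) ∷ P) (_ ∷ P-valid) = cong ((a , α) ∷_) (erase-lift P P-valid)

  proj₁-if : ∀ b (x y : RatFun) → proj₁ (if b then x else y) ≡ (if b then proj₁ x else proj₁ y)
  proj₁-if true  x y = refl
  proj₁-if false x y = refl

  -- Via proj₁-if rather than `with`: abstracting over the goal would normalise validity proofs.
  coeff-erase : ∀ {n} (L : Poly n) α → proj₁ (coeff L α) ≡ coeffX (erase L) α
  coeff-erase []            α = refl
  coeff-erase ((x , β) ∷ L) α = trans (proj₁-if (eqVecᵇ β α) (x +ᶠ coeff L α) (coeff L α))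
    (cong (λ c → if eqVecᵇ β α then proj₁ x +F c else c) (coeff-erase L α))

  ^-erase : ∀ x e → proj₁ (x ^ e) ≡ proj₁ x ^F e
  ^-erase x zero    = refl
  ^-erase x (suc e) = cong (proj₁ x *F_) (^-erase x e)

  mono-erase : ∀ {n} (xs : Vec RatFun n) α → proj₁ (mono xs α) ≡ monoEval (Vec.map proj₁ xs) α
  mono-erase []       []      = refl
  mono-erase (x ∷ xs) (a ∷ α) = cong₂ _*F_ (^-erase x a) (mono-erase xs α)

  ev-erase : ∀ {n} (L : Poly n) xs → proj₁ (ev L xs) ≡ eval (erase L) (Vec.map proj₁ xs)
  ev-erase []            xs = refl
  ev-erase ((x , β) ∷ L) xs = cong₂ _+F_ (cong (proj₁ x *F_) (mono-erase xs β)) (ev-erase L xs)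

  spectral-erase : ∀ {n} (ν : Vec ℕ n) → Vec.map proj₁ (spectral ν) ≡ bar ν
  spectral-erase ν = sym (VecP.tabulate-∘ proj₁ (λ i → point (Vec.lookup ν i) (kᵢ ν i)))

  homogeneous-erase : ∀ {n} d (L : Poly n) → erase (homogeneous d L) ≡ hom d (erase L)
  homogeneous-erase d []            = refl
  homogeneous-erase d ((x , β) ∷ L) with ∣ β ∣ ≡ᵇ d
  ... | true  = cong ((proj₁ x , β) ∷_) (homogeneous-erase d L)
  ... | false = homogeneous-erase d L

  linearCombination-erase : ∀ {n} {I : Set} (is : List I) (ι : I → Vec ℕ n) (k : I → RatFun) (G : I → Poly n)
                            (c : Vec ℕ n → Frac) (F : Vec ℕ n → PolyX n) →
                            (∀ i → proj₁ (k i) ≡ c (ι i)) → (∀ i → erase (G i) ≡ F (ι i)) →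
                            erase (linearCombination is k G) ≡ lincomb (map ι is) c F
  linearCombination-erase []       ι k G c F k≡c G≡F = refl
  linearCombination-erase (i ∷ is) ι k G c F k≡c G≡F = begin
    erase (scale (k i) (G i) ++ linearCombination is k G)
      ≡⟨ ListP.map-++ _ (scale (k i) (G i)) _ ⟩
    erase (scale (k i) (G i)) ++ erase (linearCombination is k G)
      ≡⟨ cong₂ _++_ (scale-erase (k i) (G i)) (linearCombination-erase is ι k G c F k≡c G≡F) ⟩
    scaleX (proj₁ (k i)) (erase (G i)) ++ lincomb (map ι is) c F
      ≡⟨ cong₂ (λ a P → scaleX a P ++ lincomb (map ι is) c F) (k≡c i) (G≡F i) ⟩
    scaleX (c (ι i)) (F (ι i)) ++ lincomb (map ι is) c F
      ∎
    where
    open ≡-Reasoning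
    scale-erase : ∀ k (L : Poly _) → erase (scale k L) ≡ scaleX (proj₁ k) (erase L)
    scale-erase k []            = refl
    scale-erase k ((x , β) ∷ L) = cong ((proj₁ k *F proj₁ x , β) ∷_) (scale-erase k L)

open import Data.List using (List; []; _∷_; map)
open import Data.List.Relation.Unary.All as All using (All; []; _∷_)
open import Data.Nat using (_<_; _≤_)
import Data.Nat.Properties as ℕP
open import Data.Product using (Σ; _,_; proj₁)
open import Function using (_∘_)
open import Relation.Binary.PropositionalEquality
open RationalFunction using (RatFun; _≃_; cross; 0ᶠ)
open BivariatePolynomial using (≈Q⇒≋; ≋⇒≈Q)
open Rearrangement
open Transfer

≃⇒≈F : ∀ {x y f g} → proj₁ x ≡ f → proj₁ y ≡ g → x ≃ y → f ≈F g
≃⇒≈F refl refl (cross x≃y) = ≋⇒≈Q x≃y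

≈F⇒≃ : ∀ {x y f g} → proj₁ x ≡ f → proj₁ y ≡ g → f ≈F g → x ≃ y
≈F⇒≃ {f = f} {g} refl refl f≈g = cross (≈Q⇒≋ {num f *Q den g} {num g *Q den f} f≈g)

module _ {n : ℕ} (P : PolyX n) (P-valid : ValidX P) where

  coeff-lift : ∀ α → proj₁ (coeff (lift P P-valid) α) ≡ coeffX P α
  coeff-lift α = trans (coeff-erase (lift P P-valid) α) (cong (λ Q → coeffX Q α) (erase-lift P P-valid))

  lift-degree : ∀ {d} → DegLe P d → ∀ α → d < ∣ α ∣ → coeff (lift P P-valid) α ≃ 0ᶠ
  lift-degree P≤d α d<α = ≈F⇒≃ (coeff-lift α) refl (P≤d α d<α)

  lift-vanishes : ∀ ν → eval P (bar ν) ≈F 0F → ev (lift P P-valid) (spectral ν) ≃ 0ᶠ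
  lift-vanishes ν P[ν]≈0 = ≈F⇒≃ ev-lift refl P[ν]≈0
    where
    ev-lift : proj₁ (ev (lift P P-valid) (spectral ν)) ≡ eval P (bar ν)
    ev-lift = trans (ev-erase (lift P P-valid) (spectral ν)) (cong₂ eval (erase-lift P P-valid) (spectral-erase ν))

Estar-vanishes-below : ∀ {n} {μ : Vec ℕ n} {E} → IsEstar μ E → ∀ ν → ∣ ν ∣ < ∣ μ ∣ → eval E (bar ν) ≈F 0F
Estar-vanishes-below hE ν ν<μ = IsEstar.vanish hE ν (ℕP.<⇒≤ ν<μ) (λ ν≡μ → ℕP.<-irrefl (cong ∣_∣ ν≡μ) ν<μ)

Fstar-degree : ∀ {n} (μ : Vec ℕ n) {ν F} → IsRearr μ ν → IsFstar ν F → DegLe F ∣ μ ∣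
Fstar-degree μ {ν} {F} ν~μ hF = subst (DegLe F) (rearrangement-size μ ν ν~μ) (IsFstar.degree hF)

Fstar-vanishes-below : ∀ {n} (μ : Vec ℕ n) {ν F} → IsRearr μ ν → IsFstar ν F →
                       ∀ ν′ → ∣ ν′ ∣ < ∣ μ ∣ → eval F (bar ν′) ≈F 0F
Fstar-vanishes-below μ {ν} ν~μ hF ν′ ν′<μ =
  IsFstar.vanish hF ν′ (subst (∣ ν′ ∣ ≤_) (sym (rearrangement-size μ ν ν~μ)) (ℕP.<⇒≤ ν′<μ))
    (λ ν′~ν → ℕP.<-irrefl (trans (rearrangement-size ν ν′ ν′~ν) (rearrangement-size μ ν ν~μ)) ν′<μ)

map-proj₁-toList : ∀ {A : Set} {P : A → Set} {xs} (pxs : All P xs) → map proj₁ (All.toList pxs) ≡ xs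
map-proj₁-toList []         = refl
map-proj₁-toList (px ∷ pxs) = cong (_ ∷_) (map-proj₁-toList pxs)

module Lifting {n} {μ : Vec ℕ n} {E : PolyX n} {F : Vec ℕ n → PolyX n} {c : Vec ℕ n → Frac}
               (E-star : IsEstar μ E) (F-star : ∀ ν → IsRearr μ ν → IsFstar ν (F ν))
               (c-valid : ∀ ν → IsRearr μ ν → Valid (c ν)) where

  open ≡-Reasoning

  Eᶠ : Poly n
  Eᶠ = lift E (IsEstar.valid E-star)

  Index : Set
  Index = Σ (Vec ℕ n) (IsRearr μ)

  indices : List Index
  indices = All.toList (rearr-sound μ)

  cᶠ : Index → RatFun
  cᶠ (ν , ν~μ) = c ν , c-valid ν ν~μ

  Fᶠ : Index → Poly n
  Fᶠ (ν , ν~μ) = lift (F ν) (IsFstar.valid (F-star ν ν~μ))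

  Eᶠ-degree : ∀ α → ∣ μ ∣ < ∣ α ∣ → coeff Eᶠ α ≃ 0ᶠ
  Eᶠ-degree = lift-degree E (IsEstar.valid E-star) (IsEstar.degree E-star)

  Eᶠ-vanishes : ∀ ν → ∣ ν ∣ < ∣ μ ∣ → ev Eᶠ (spectral ν) ≃ 0ᶠ
  Eᶠ-vanishes ν ν<μ = lift-vanishes E (IsEstar.valid E-star) ν (Estar-vanishes-below E-star ν ν<μ)

  Fᶠ-degree : ∀ i α → ∣ μ ∣ < ∣ α ∣ → coeff (Fᶠ i) α ≃ 0ᶠ
  Fᶠ-degree (ν , ν~μ) = lift-degree (F ν) (IsFstar.valid (F-star ν ν~μ)) (Fstar-degree μ ν~μ (F-star ν ν~μ))

  Fᶠ-vanishes : ∀ i ν′ → ∣ ν′ ∣ < ∣ μ ∣ → ev (Fᶠ i) (spectral ν′) ≃ 0ᶠ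
  Fᶠ-vanishes (ν , ν~μ) ν′ ν′<μ =
    lift-vanishes (F ν) (IsFstar.valid (F-star ν ν~μ)) ν′ (Fstar-vanishes-below μ ν~μ (F-star ν ν~μ) ν′ ν′<μ)

  module _ (G : Poly n → Poly n) (G′ : PolyX n → PolyX n) (G-erase : ∀ L → erase (G L) ≡ G′ (erase L)) where

    coeff-Eᶠ : ∀ α → proj₁ (coeff (G Eᶠ) α) ≡ coeffX (G′ E) α
    coeff-Eᶠ α = begin
      proj₁ (coeff (G Eᶠ) α)     ≡⟨ coeff-erase (G Eᶠ) α ⟩
      coeffX (erase (G Eᶠ)) α    ≡⟨ cong (λ Q → coeffX Q α) (G-erase Eᶠ) ⟩
      coeffX (G′ (erase Eᶠ)) α   ≡⟨ cong (λ Q → coeffX (G′ Q) α) (erase-lift E (IsEstar.valid E-star)) ⟩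
      coeffX (G′ E) α            ∎

    erase-combination : erase (linearCombination indices cᶠ (G ∘ Fᶠ)) ≡ lincomb (map proj₁ indices) c (G′ ∘ F)
    erase-combination = linearCombination-erase indices proj₁ cᶠ (G ∘ Fᶠ) c (G′ ∘ F) (λ _ → refl)
      (λ (ν , ν~μ) → trans (G-erase (Fᶠ (ν , ν~μ))) (cong G′ (erase-lift (F ν) (IsFstar.valid (F-star ν ν~μ)))))

    coeff-combination : ∀ α → proj₁ (coeff (linearCombination indices cᶠ (G ∘ Fᶠ)) α)
                                ≡ coeffX (lincomb (rearr μ) c (G′ ∘ F)) α
    coeff-combination α = begin
      proj₁ (coeff (linearCombination indices cᶠ (G ∘ Fᶠ)) α)
        ≡⟨ coeff-erase (linearCombination indices cᶠ (G ∘ Fᶠ)) α ⟩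
      coeffX (erase (linearCombination indices cᶠ (G ∘ Fᶠ))) α
        ≡⟨ cong (λ Q → coeffX Q α) erase-combination ⟩
      coeffX (lincomb (map proj₁ indices) c (G′ ∘ F)) α
        ≡⟨ cong (λ νs → coeffX (lincomb νs c (G′ ∘ F)) α) (map-proj₁-toList (rearr-sound μ)) ⟩
      coeffX (lincomb (rearr μ) c (G′ ∘ F)) α
        ∎

lemmaA5 : (n : ℕ) (μ : Vec ℕ n) (E : PolyX n) (F : Vec ℕ n → PolyX n) (c : Vec ℕ n → Frac) →
          IsEstar μ E →
          (∀ ν → IsRearr μ ν → IsFstar ν (F ν)) →
          (∀ ν → IsRearr μ ν → Valid (c ν)) →
          hom ∣ μ ∣ E ≈X lincomb (rearr μ) c (λ ν → hom ∣ μ ∣ (F ν)) →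
          E ≈X lincomb (rearr μ) c F
lemmaA5 n μ E F c hE hF hc top α =
  ≃⇒≈F (coeff-Eᶠ (λ P → P) (λ P → P) (λ _ → refl) α) (coeff-combination (λ P → P) (λ P → P) (λ _ → refl) α)
    (top-degree-determines ∣ μ ∣ Eᶠ indices cᶠ Fᶠ Eᶠ-degree Eᶠ-vanishes Fᶠ-degree Fᶠ-vanishes top-degree α)
  where
  open Lifting {c = c} hE hF hc
  top-degree : ∀ β → coeff (homogeneous ∣ μ ∣ Eᶠ) β
                      ≃ coeff (linearCombination indices cᶠ (homogeneous ∣ μ ∣ ∘ Fᶠ)) β
  top-degree β = ≈F⇒≃ (coeff-Eᶠ (homogeneous ∣ μ ∣) (hom ∣ μ ∣) (homogeneous-erase ∣ μ ∣) β)
                      (coeff-combination (homogeneous ∣ μ ∣) (hom ∣ μ ∣) (homogeneous-erase ∣ μ ∣) β) (top β)
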